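{- Let $\beta_4 \in S_n$ be a $4$-cycle. Then \begin{enumerate} \item $c(0, \beta_4) = 4(n-4)!$ for $n \geq 4$; \item $c(3, \beta_4) = (4n-12)\cdot 4(n-4)!$ for $n \geq 4$; \item $c(4, \beta_4) = \left(1+8(n-4)\right)\cdot 4(n-4)!$ for $n \geq 4$; \item $c(5, \beta_4) = \left(12(n-4)+8\binom{n-4}{2}\right)\cdot 4(n-4)!$ for $n \geq 5$; \item $c(6, \beta_4)=\left(14n^2-126n+280\right)\cdot 4(n-4)!$ for $n \geq 6$; \item $c(7, \beta_4)= 24\binom{n-4}{3}\cdot 4(n-4)!$ for $n\geq 7$; \item $c(8, \beta_4) = 6 \binom{n-4}{4}\cdot 4(n-4)!$ for $n \geq 8$; \item $c(k, \beta_4)=0$ for every integer $k$ with $9 \leq k \leq n$. \end{enumerate}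
   Context: $S_n$ is the group of permutations of $[n]=\{1,\dots,n\}$; products are composed right to left. The Hamming distance between $\sigma,\tau\in S_n$ is $H(\sigma,\tau)=|\{a\in[n]:\sigma(a)\neq\tau(a)\}|$. Two permutations $\alpha,\beta\in S_n$ $k$-commute if $H(\alpha\beta,\beta\alpha)=k$. For $\beta\in S_n$ and a nonnegative integer $k$, $c(k,\beta)$ denotes the number of $\alpha\in S_n$ that $k$-commute with $\beta$. A $4$-cycle in $S_n$ is a permutation whose disjoint cycle factorization consists of one cycle of length $4$ and $n-4$ fixed points. -}

module Defs where

open import Data.Nat using (ℕ; zero; suc)
open import Data.Fin using (Fin)
open import Data.Fin.Properties using (_≟_)
open import Data.Vec using (Vec; []; _∷_; lookup; toList; tabulate)
open import Data.List using (List; []; _∷_; [_]; map; concatMap; filter; length; allFin)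
open import Data.List.Relation.Unary.AllPairs using (AllPairs; allPairs?)
open import Data.Product using (∃-syntax; _×_)
open import Relation.Nullary using (¬_; ¬?)
open import Relation.Nullary.Decidable using (Dec)
open import Relation.Binary.PropositionalEquality using (_≡_; _≢_)

-- A map [n] → [n] is encoded by its table of values: σ(a) = lookup σ a.
Map : ℕ → Set
Map n = Vec (Fin n) n

-- σ ∈ S_n : the table has pairwise distinct entries (injective, hence bijective).
IsPerm : ∀ {n} → Map n → Set
IsPerm σ = AllPairs _≢_ (toList σ)

isPerm? : ∀ {n} (σ : Map n) → Dec (IsPerm σ)
isPerm? σ = allPairs? (λ x y → ¬? (x ≟ y)) (toList σ)

-- Composition, right to left: (σ ∘ₚ τ)(a) = σ(τ(a)).
_∘ₚ_ : ∀ {n} → Map n → Map n → Map n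
σ ∘ₚ τ = tabulate (λ a → lookup σ (lookup τ a))

H : ∀ {n} → Map n → Map n → ℕ
H σ τ = length (filter (λ a → ¬? (lookup σ a ≟ lookup τ a)) (allFin _))

allVecs : ∀ m n → List (Vec (Fin n) m)
allVecs zero n = [ [] ]
allVecs (suc m) n = concatMap (λ x → map (x ∷_) (allVecs m n)) (allFin n)

Sym : ∀ n → List (Map n)
Sym n = filter isPerm? (allVecs n n)

c : ∀ {n} → ℕ → Map n → ℕ
c {n} k β = length (filter (λ α → Data.Nat._≟_ (H (α ∘ₚ β) (β ∘ₚ α)) k) (Sym n))
  where import Data.Nat

IsFourCycle : ∀ {n} → Map n → Set
IsFourCycle {n} β =
  ∃[ a ] ∃[ b ] ∃[ c′ ] ∃[ d ]
    (a ≢ b × a ≢ c′ × a ≢ d × b ≢ c′ × b ≢ d × c′ ≢ d)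
    × (lookup β a ≡ b × lookup β b ≡ c′ × lookup β c′ ≡ d × lookup β d ≡ a)
    × (∀ (x : Fin n) → x ≢ a → x ≢ b → x ≢ c′ → x ≢ d → lookup β x ≡ x)

module Submission where

-- For α ∈ S_n let d(α) = H(αβ, βα) = #{y : αβy ≠ βαy}.  The skeleton of α records for each
-- cycle point whether α sends it to a cycle point (and which) or off the cycle.  At a cycle
-- point the test αβy ≠ βαy depends only on the skeleton (its "mismatches"); at an off-cycle
-- point y, where βy = y, it holds iff αy lies on the cycle.  As α is a bijection, exactly as
-- many off-cycle points go onto the cycle as cycle points are "missed" by the image of the
-- cycle.  So d(α) = mismatches σ + missed σ when α has skeleton σ, and a clash-free skeleton
-- σ is the skeleton of fall m (escapes σ) · m! permutations, escapes σ being the number of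
-- cycle points sent off the cycle.

open import Defs
open import Data.Nat using (ℕ; zero; suc; _+_; _*_; _∸_; _^_; _≤_; _<_; _!; pred; z≤n; s≤s; _≡ᵇ_)
open import Data.Nat.Properties hiding (_≟_)
open import Data.Nat.Combinatorics using (_C_; nCk+nC[k+1]≡[n+1]C[k+1])
open import Data.Nat.Tactic.RingSolver using (solve-∀)
open import Algebra.Properties.CommutativeSemigroup +-commutativeSemigroup using (interchange)
open import Data.Bool using (Bool; true; false; not; _∧_; _∨_; T)
open import Data.Bool.Properties using (∧-zeroʳ)
open import Data.Fin using (Fin; zero; suc; toℕ)
open import Data.Fin.Properties using (_≟_; any?)
import Data.Fin.Properties as Fin
open import Data.Maybe using (Maybe; just; nothing; is-just; is-nothing)
import Data.Maybe.Properties as Maybe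
open import Data.List using (List; []; _∷_; _++_; map; concatMap; filter; length; allFin)
open import Data.List.Relation.Unary.All as All using (All; []; _∷_)
open import Data.List.Relation.Unary.AllPairs using (AllPairs; []; _∷_)
open import Data.Vec using (Vec; []; _∷_; lookup; tabulate; toList)
import Data.Vec.Properties as Vec
open import Data.Product using (Σ; _×_; _,_; proj₁; proj₂)
open import Data.Empty using (⊥-elim)
open import Relation.Nullary using (Dec; yes; no; does; ¬_; ¬?)
open import Relation.Nullary.Decidable using (dec-true; dec-false)
open import Relation.Unary using (Pred; Decidable)
open import Relation.Binary.PropositionalEquality

𝟙 : Bool → ℕ
𝟙 true = 1
𝟙 false = 0

𝟙-∧ : ∀ a b → 𝟙 (a ∧ b) ≡ 𝟙 a * 𝟙 b
𝟙-∧ true b = sym (+-identityʳ (𝟙 b))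
𝟙-∧ false b = refl

∧-split : ∀ {a b} → (a ∧ b) ≡ true → a ≡ true × b ≡ true
∧-split {true} {true} _ = refl , refl

false≢true : false ≢ true
false≢true ()

≡true⇒T : ∀ {b} → b ≡ true → T b
≡true⇒T refl = _

Bool-ext : ∀ {a b : Bool} → (a ≡ true → b ≡ true) → (b ≡ true → a ≡ true) → a ≡ b
Bool-ext {false} {false} _ _ = refl
Bool-ext {false} {true} _ b⇒a = b⇒a refl
Bool-ext {true} {false} a⇒b _ = sym (a⇒b refl)
Bool-ext {true} {true} _ _ = refl

allFinᵇ : ∀ {r} → (Fin r → Bool) → Bool
allFinᵇ {zero} g = true
allFinᵇ {suc r} g = g zero ∧ allFinᵇ (λ i → g (suc i))

allFinᵇ-elim : ∀ {r} (g : Fin r → Bool) → allFinᵇ g ≡ true → ∀ i → g i ≡ true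
allFinᵇ-elim g all zero = proj₁ (∧-split {g zero} all)
allFinᵇ-elim g all (suc i) = allFinᵇ-elim (λ i → g (suc i)) (proj₂ (∧-split {g zero} all)) i

allFinᵇ-intro : ∀ {r} (g : Fin r → Bool) → (∀ i → g i ≡ true) → allFinᵇ g ≡ true
allFinᵇ-intro {zero} g all = refl
allFinᵇ-intro {suc r} g all rewrite all zero = allFinᵇ-intro (λ i → g (suc i)) (λ i → all (suc i))

allFinᵇ-cong : ∀ {r} {g h : Fin r → Bool} → (∀ i → g i ≡ h i) → allFinᵇ g ≡ allFinᵇ h
allFinᵇ-cong {zero} g≗h = refl
allFinᵇ-cong {suc r} g≗h = cong₂ _∧_ (g≗h zero) (allFinᵇ-cong (λ i → g≗h (suc i)))

sumList : {A : Set} → (A → ℕ) → List A → ℕ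
sumList f [] = 0
sumList f (x ∷ xs) = f x + sumList f xs

sumFin : ∀ {n} → (Fin n → ℕ) → ℕ
sumFin {zero} f = 0
sumFin {suc n} f = f zero + sumFin (λ i → f (suc i))

module _ {A : Set} where

  sumList-cong : ∀ {f g : A → ℕ} xs → (∀ x → f x ≡ g x) → sumList f xs ≡ sumList g xs
  sumList-cong [] f≗g = refl
  sumList-cong (x ∷ xs) f≗g = cong₂ _+_ (f≗g x) (sumList-cong xs f≗g)

  sumList-zero : ∀ (f : A → ℕ) xs → (∀ x → f x ≡ 0) → sumList f xs ≡ 0
  sumList-zero f [] f≗0 = refl
  sumList-zero f (x ∷ xs) f≗0 rewrite f≗0 x = sumList-zero f xs f≗0

  sumList-++ : ∀ (f : A → ℕ) xs ys → sumList f (xs ++ ys) ≡ sumList f xs + sumList f ys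
  sumList-++ f [] ys = refl
  sumList-++ f (x ∷ xs) ys = trans (cong (f x +_) (sumList-++ f xs ys)) (sym (+-assoc (f x) _ _))

  sumList-+ : ∀ (f g : A → ℕ) xs → sumList (λ x → f x + g x) xs ≡ sumList f xs + sumList g xs
  sumList-+ f g [] = refl
  sumList-+ f g (x ∷ xs) =
    trans (cong (f x + g x +_) (sumList-+ f g xs)) (interchange (f x) (g x) (sumList f xs) (sumList g xs))

  sumList-*ʳ : ∀ (f : A → ℕ) k xs → sumList (λ x → f x * k) xs ≡ sumList f xs * k
  sumList-*ʳ f k [] = refl
  sumList-*ʳ f k (x ∷ xs) = trans (cong (f x * k +_) (sumList-*ʳ f k xs)) (sym (*-distribʳ-+ k (f x) (sumList f xs)))

  sumList-*ˡ : ∀ k (f : A → ℕ) xs → sumList (λ x → k * f x) xs ≡ k * sumList f xs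
  sumList-*ˡ k f xs =
    trans (sumList-cong xs (λ x → *-comm k (f x))) (trans (sumList-*ʳ f k xs) (*-comm (sumList f xs) k))

  sumList-filter : ∀ {ℓ} {P : Pred A ℓ} (P? : Decidable P) (f : A → ℕ) xs →
    sumList f (filter P? xs) ≡ sumList (λ x → 𝟙 (does (P? x)) * f x) xs
  sumList-filter P? f [] = refl
  sumList-filter P? f (x ∷ xs) with does (P? x)
  ... | true = cong₂ _+_ (sym (+-identityʳ (f x))) (sumList-filter P? f xs)
  ... | false = sumList-filter P? f xs

  length≡sumList : (xs : List A) → length xs ≡ sumList (λ _ → 1) xs
  length≡sumList [] = refl
  length≡sumList (x ∷ xs) = cong suc (length≡sumList xs)

sumList-concatMap : ∀ {A B : Set} (f : B → ℕ) (g : A → List B) xs →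
  sumList f (concatMap g xs) ≡ sumList (λ x → sumList f (g x)) xs
sumList-concatMap f g [] = refl
sumList-concatMap f g (x ∷ xs) =
  trans (sumList-++ f (g x) (concatMap g xs)) (cong (sumList f (g x) +_) (sumList-concatMap f g xs))

sumList-map : ∀ {A B : Set} (f : B → ℕ) (g : A → B) xs → sumList f (map g xs) ≡ sumList (λ x → f (g x)) xs
sumList-map f g [] = refl
sumList-map f g (x ∷ xs) = cong (f (g x) +_) (sumList-map f g xs)

sumList-swap : ∀ {A B : Set} (f : A → B → ℕ) xs ys →
  sumList (λ x → sumList (f x) ys) xs ≡ sumList (λ y → sumList (λ x → f x y) xs) ys
sumList-swap f [] ys = sym (sumList-zero _ ys (λ _ → refl))
sumList-swap f (x ∷ xs) ys = trans (cong (sumList (f x) ys +_) (sumList-swap f xs ys)) (sym (sumList-+ (f x) _ ys))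

sumList-allFin : ∀ {n} (f : Fin n → ℕ) → sumList f (allFin n) ≡ sumFin f
sumList-allFin {n} f = go (λ i → i)
  where
  go : ∀ {k} (g : Fin k → Fin n) → sumList f (Data.List.tabulate g) ≡ sumFin (λ i → f (g i))
  go {zero} g = refl
  go {suc k} g = cong (f (g zero) +_) (go (λ i → g (suc i)))

sumFin-cong : ∀ {n} {f g : Fin n → ℕ} → (∀ i → f i ≡ g i) → sumFin f ≡ sumFin g
sumFin-cong {zero} f≗g = refl
sumFin-cong {suc n} f≗g = cong₂ _+_ (f≗g zero) (sumFin-cong (λ i → f≗g (suc i)))

sumFin-zero : ∀ {n} (f : Fin n → ℕ) → (∀ i → f i ≡ 0) → sumFin f ≡ 0
sumFin-zero {zero} f f≗0 = refl
sumFin-zero {suc n} f f≗0 rewrite f≗0 zero = sumFin-zero _ (λ i → f≗0 (suc i))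

sumFin-+ : ∀ {n} (f g : Fin n → ℕ) → sumFin (λ i → f i + g i) ≡ sumFin f + sumFin g
sumFin-+ {zero} f g = refl
sumFin-+ {suc n} f g = trans (cong (f zero + g zero +_) (sumFin-+ (λ i → f (suc i)) (λ i → g (suc i))))
  (interchange (f zero) (g zero) (sumFin (λ i → f (suc i))) (sumFin (λ i → g (suc i))))

sumFin-*ʳ : ∀ {n} (f : Fin n → ℕ) k → sumFin (λ i → f i * k) ≡ sumFin f * k
sumFin-*ʳ {zero} f k = refl
sumFin-*ʳ {suc n} f k = trans (cong (f zero * k +_) (sumFin-*ʳ (λ i → f (suc i)) k))
  (sym (*-distribʳ-+ k (f zero) (sumFin (λ i → f (suc i)))))

sumFin-const : ∀ n → sumFin {n} (λ _ → 1) ≡ n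
sumFin-const zero = refl
sumFin-const (suc n) = cong suc (sumFin-const n)

sumFin-𝟙≤ : ∀ {r} (g : Fin r → Bool) → sumFin (λ i → 𝟙 (g i)) ≤ r
sumFin-𝟙≤ {zero} g = z≤n
sumFin-𝟙≤ {suc r} g = +-mono-≤ (𝟙≤1 (g zero)) (sumFin-𝟙≤ (λ i → g (suc i)))
  where
  𝟙≤1 : ∀ b → 𝟙 b ≤ 1
  𝟙≤1 true = s≤s z≤n
  𝟙≤1 false = z≤n

sumList-sumFin : ∀ {A : Set} {r} (F : A → Fin r → ℕ) xs →
  sumList (λ x → sumFin (F x)) xs ≡ sumFin (λ j → sumList (λ x → F x j) xs)
sumList-sumFin {r = r} F [] = sym (sumFin-zero {r} _ (λ _ → refl))
sumList-sumFin F (x ∷ xs) =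
  trans (cong (sumFin (F x) +_) (sumList-sumFin F xs)) (sym (sumFin-+ (F x) (λ j → sumList (λ x → F x j) xs)))

sumFin-swap : ∀ {r s} (F : Fin r → Fin s → ℕ) → sumFin (λ x → sumFin (F x)) ≡ sumFin (λ j → sumFin (λ x → F x j))
sumFin-swap {r} F = begin
    sumFin (λ x → sumFin (F x))                          ≡⟨ sumList-allFin (λ x → sumFin (F x)) ⟨
    sumList (λ x → sumFin (F x)) (allFin r)              ≡⟨ sumList-sumFin F (allFin r) ⟩
    sumFin (λ j → sumList (λ x → F x j) (allFin r))      ≡⟨ sumFin-cong (λ j → sumList-allFin (λ x → F x j)) ⟩
    sumFin (λ j → sumFin (λ x → F x j))                  ∎
  where open ≡-Reasoning

_==_ : ∀ {n} → Fin n → Fin n → Bool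
x == y = does (x ≟ y)

module _ {n : ℕ} where

  ==-refl : (x : Fin n) → (x == x) ≡ true
  ==-refl x = dec-true (x ≟ x) refl

  ==-≢ : {x y : Fin n} → x ≢ y → (x == y) ≡ false
  ==-≢ {x} {y} = dec-false (x ≟ y)

  ==-sym : (x y : Fin n) → (x == y) ≡ (y == x)
  ==-sym x y with x ≟ y | y ≟ x
  ... | yes _ | yes _ = refl
  ... | no _ | no _ = refl
  ... | yes x≡y | no y≢x = ⊥-elim (y≢x (sym x≡y))
  ... | no x≢y | yes y≡x = ⊥-elim (x≢y (sym y≡x))

  sumFin-point : (x : Fin n) (g : Fin n → ℕ) → sumFin (λ y → 𝟙 (y == x) * g y) ≡ g x
  sumFin-point x g = trans (sumFin-cong at-x) (trans (sumFin-*ʳ (λ y → 𝟙 (y == x)) (g x)) (trans (cong (_* g x) (count x)) (*-identityˡ (g x))))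
    where
    at-x : ∀ y → 𝟙 (y == x) * g y ≡ 𝟙 (y == x) * g x
    at-x y with y ≟ x
    ... | yes refl = refl
    ... | no _ = refl
    count : ∀ {n} (x : Fin n) → sumFin (λ y → 𝟙 (y == x)) ≡ 1
    count {suc n} zero = cong suc (sumFin-zero {n} (λ i → 𝟙 (suc i == zero)) (λ _ → refl))
    count (suc x) = count x

==-injective : ∀ {r s} (f : Fin r → Fin s) → (∀ {i j} → f i ≡ f j → i ≡ j) → ∀ i j → (f i == f j) ≡ (i == j)
==-injective f inj i j with i ≟ j
... | yes refl = ==-refl (f i)
... | no i≢j = ==-≢ (λ fi≡fj → i≢j (inj fi≡fj))

-- Scanning a vector left to right, L is the list of values already used.
module DistinctLists {N : ℕ} where

  infix 4 _∉ᵇ_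

  _∉ᵇ_ : Fin N → List (Fin N) → Bool
  x ∉ᵇ [] = true
  x ∉ᵇ (y ∷ L) = not (x == y) ∧ (x ∉ᵇ L)

  distinctFrom : List (Fin N) → List (Fin N) → Bool
  distinctFrom L [] = true
  distinctFrom L (x ∷ l) = (x ∉ᵇ L) ∧ distinctFrom (x ∷ L) l

  ∉ᵇ-∷ : ∀ {x y} L → x ≢ y → (x ∉ᵇ y ∷ L) ≡ (x ∉ᵇ L)
  ∉ᵇ-∷ {x} {y} L x≢y rewrite ==-≢ x≢y = refl

  ∉ᵇ-self : ∀ x L → (x ∉ᵇ x ∷ L) ≡ false
  ∉ᵇ-self x L rewrite ==-refl x = refl

  _⊆ᵇ_ : List (Fin N) → List (Fin N) → Set
  L ⊆ᵇ L′ = ∀ y → (y ∉ᵇ L′) ≡ true → (y ∉ᵇ L) ≡ true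

  ⊆ᵇ-∷ : ∀ x {L L′} → L ⊆ᵇ L′ → (x ∷ L) ⊆ᵇ (x ∷ L′)
  ⊆ᵇ-∷ x L⊆L′ y h with y ≟ x
  ... | yes _ = h
  ... | no _ = L⊆L′ y h

  ⊆ᵇ-drop : ∀ x L → L ⊆ᵇ (x ∷ L)
  ⊆ᵇ-drop x L y h = proj₂ (∧-split {not (y == x)} h)

  ⊆ᵇ-swap : ∀ x y L → (x ∷ y ∷ L) ⊆ᵇ (y ∷ x ∷ L)
  ⊆ᵇ-swap x y L z h with z == x | z == y
  ... | true | true = h
  ... | true | false = h
  ... | false | true = h
  ... | false | false = h

  distinctFrom-antitone : ∀ {L L′} E → L ⊆ᵇ L′ → distinctFrom L′ E ≡ true → distinctFrom L E ≡ true
  distinctFrom-antitone [] L⊆L′ d = refl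
  distinctFrom-antitone {L} {L′} (x ∷ E) L⊆L′ d with ∧-split {x ∉ᵇ L′} d
  ... | x∉L′ , dE rewrite L⊆L′ x x∉L′ = distinctFrom-antitone {x ∷ L} {x ∷ L′} E (⊆ᵇ-∷ x {L} {L′} L⊆L′) dE

  distinctFrom-∉ : ∀ x L E → distinctFrom (x ∷ L) E ≡ true → (x ∉ᵇ E) ≡ true
  distinctFrom-∉ x L [] d = refl
  distinctFrom-∉ x L (y ∷ E) d with ∧-split {y ∉ᵇ x ∷ L} d
  ... | y∉xL , dE with ∧-split {not (y == x)} y∉xL
  ... | y≠x , _ rewrite ==-sym x y | y≠x =
    distinctFrom-∉ x (y ∷ L) E (distinctFrom-antitone E (⊆ᵇ-swap x y L) dE)

  distinctFrom-∷ : ∀ x L E → distinctFrom L E ≡ true → (x ∉ᵇ E) ≡ true → distinctFrom (x ∷ L) E ≡ true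
  distinctFrom-∷ x L [] d x∉E = refl
  distinctFrom-∷ x L (y ∷ E) d x∉yE with ∧-split {y ∉ᵇ L} d | ∧-split {not (x == y)} x∉yE
  ... | y∉L , dE | x≠y , x∉E rewrite ==-sym y x | x≠y | y∉L =
    distinctFrom-antitone E (⊆ᵇ-swap y x L) (distinctFrom-∷ x (y ∷ L) E dE x∉E)

  distinctFrom-drop : ∀ x L E → distinctFrom L E ≡ false → distinctFrom (x ∷ L) E ≡ false
  distinctFrom-drop x L E d with distinctFrom (x ∷ L) E in dx
  ... | false = refl
  ... | true = trans (sym (distinctFrom-antitone E (⊆ᵇ-drop x L) dx)) d

  ∉ᵇ⇒≢ : ∀ {x y} L → (y ∉ᵇ x ∷ L) ≡ true → x ≢ y
  ∉ᵇ⇒≢ {x} L h refl = false≢true (trans (sym (∉ᵇ-self x L)) h)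

  distinctFrom-avoids : ∀ L l → distinctFrom L l ≡ true → All (λ y → (y ∉ᵇ L) ≡ true) l
  distinctFrom-avoids L [] d = []
  distinctFrom-avoids L (x ∷ l) d with ∧-split {x ∉ᵇ L} d
  ... | x∉L , dl = x∉L ∷ All.map (λ {y} → ⊆ᵇ-drop x L y) (distinctFrom-avoids (x ∷ L) l dl)

  distinctFrom-sound : ∀ L l → distinctFrom L l ≡ true → AllPairs _≢_ l
  distinctFrom-sound L [] d = []
  distinctFrom-sound L (x ∷ l) d with ∧-split {x ∉ᵇ L} d
  ... | _ , dl = All.map (∉ᵇ⇒≢ L) (distinctFrom-avoids (x ∷ L) l dl) ∷ distinctFrom-sound (x ∷ L) l dl

  distinctFrom-complete : ∀ L l → AllPairs _≢_ l → All (λ y → (y ∉ᵇ L) ≡ true) l → distinctFrom L l ≡ true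
  distinctFrom-complete L [] _ _ = refl
  distinctFrom-complete L (x ∷ l) (x≢l ∷ dl) (x∉L ∷ l∉L) rewrite x∉L =
    distinctFrom-complete (x ∷ L) l dl (All.zipWith avoid-x (x≢l , l∉L))
    where
    avoid-x : ∀ {y} → x ≢ y × (y ∉ᵇ L) ≡ true → (y ∉ᵇ x ∷ L) ≡ true
    avoid-x (x≢y , y∉L) = trans (∉ᵇ-∷ L (λ y≡x → x≢y (sym y≡x))) y∉L

  distinctFrom-[] : ∀ l → AllPairs _≢_ l → distinctFrom [] l ≡ true
  distinctFrom-[] l d = distinctFrom-complete [] l d (All.universal (λ _ → refl) l)

All-lookup : ∀ {A : Set} {P : A → Set} {r} (v : Vec A r) → All P (toList v) → ∀ j → P (lookup v j)
All-lookup (y ∷ v) (py ∷ pv) zero = py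
All-lookup (y ∷ v) (py ∷ pv) (suc j) = All-lookup v pv j

lookup-injective : ∀ {A : Set} {r} (v : Vec A r) → AllPairs _≢_ (toList v) →
  ∀ i j → lookup v i ≡ lookup v j → i ≡ j
lookup-injective (x ∷ v) _ zero zero _ = refl
lookup-injective (x ∷ v) (x≢v ∷ _) zero (suc j) x≡vj = ⊥-elim (All-lookup v x≢v j x≡vj)
lookup-injective (x ∷ v) (x≢v ∷ _) (suc i) zero vi≡x = ⊥-elim (All-lookup v x≢v i (sym vi≡x))
lookup-injective (x ∷ v) (_ ∷ dv) (suc i) (suc j) vi≡vj = cong suc (lookup-injective v dv i j vi≡vj)

-- The falling factorial fall m k = m (m-1) ⋯ (m-k+1) counts injective maps from a
-- k-set into an m-set.
fall : ℕ → ℕ → ℕ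
fall m zero = 1
fall m (suc k) = m * fall (pred m) k

fall-vanishes : ∀ m k → m < k → fall m k ≡ 0
fall-vanishes zero (suc k) _ = refl
fall-vanishes (suc m) (suc k) (s≤s m<k) rewrite fall-vanishes m k m<k = *-zeroʳ m

fall-suc : ∀ m k → fall m (suc k) ≡ fall m k * (m ∸ k)
fall-suc zero k = sym (trans (cong (fall zero k *_) (0∸n≡0 k)) (*-zeroʳ (fall zero k)))
fall-suc (suc m) zero = trans (*-identityʳ (suc m)) (sym (+-identityʳ (suc m)))
fall-suc (suc m) (suc k) =
  trans (cong (suc m *_) (fall-suc m k)) (sym (*-assoc (suc m) (fall m k) (m ∸ k)))

-- Pascal's rule for the falling factorial gives fall m k = k! · C(m, k).
fall≡!*C : ∀ m k → fall m k ≡ k ! * (m C k)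
fall≡!*C m zero = refl
fall≡!*C zero (suc k) = sym (*-zeroʳ (suc k !))
fall≡!*C (suc m) (suc k) = begin
    suc m * fall m k                              ≡⟨ pascal k m ⟩
    fall m k * suc k + fall m (suc k)             ≡⟨ cong₂ _+_ (cong (_* suc k) (fall≡!*C m k)) (fall≡!*C m (suc k)) ⟩
    k ! * (m C k) * suc k + suc k ! * (m C suc k) ≡⟨ regroup (k !) (m C k) k (m C suc k) ⟩
    suc k ! * (m C k + m C suc k)                 ≡⟨ cong (suc k ! *_) (nCk+nC[k+1]≡[n+1]C[k+1] m k) ⟩
    suc k ! * (suc m C suc k)                     ∎
  where
  open ≡-Reasoning
  regroup : ∀ F a k b → F * a * suc k + (suc k * F) * b ≡ (suc k * F) * (a + b)
  regroup = solve-∀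
  pascal : ∀ k m → suc m * fall m k ≡ fall m k * suc k + fall m (suc k)
  pascal k m with k ≤? m
  ... | yes k≤m = begin
      suc m * fall m k                         ≡⟨ *-comm (suc m) (fall m k) ⟩
      fall m k * suc m                         ≡⟨ cong (λ z → fall m k * suc z) (m+[n∸m]≡n k≤m) ⟨
      fall m k * (suc k + (m ∸ k))             ≡⟨ *-distribˡ-+ (fall m k) (suc k) (m ∸ k) ⟩
      fall m k * suc k + fall m k * (m ∸ k)    ≡⟨ cong (fall m k * suc k +_) (fall-suc m k) ⟨
      fall m k * suc k + fall m (suc k)        ∎
  ... | no k≰m rewrite fall-vanishes m k (≰⇒> k≰m) | fall-vanishes m (suc k) (m<n⇒m<1+n (≰⇒> k≰m)) | *-zeroʳ m = refl

-- When f+1 free and q outside slots exactly use up u inner and M outer values, the two ways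
-- of filling the first free slot (an inner or an outer value) add up to fall M q · (f+1).
fall-balance : ∀ u M q f → suc f + q ≡ u + M → u * fall M q + M * fall (pred M) q ≡ fall M q * suc f
fall-balance u M q f balanced with q ≤? M
... | yes q≤M = begin
    u * fall M q + M * fall (pred M) q       ≡⟨ cong₂ _+_ (*-comm u (fall M q)) (fall-suc M q) ⟩
    fall M q * u + fall M q * (M ∸ q)        ≡⟨ *-distribˡ-+ (fall M q) u (M ∸ q) ⟨
    fall M q * (u + (M ∸ q))                 ≡⟨ cong (fall M q *_) spare ⟩
    fall M q * suc f                         ∎
  where
  open ≡-Reasoning
  spare : u + (M ∸ q) ≡ suc f
  spare = +-cancelʳ-≡ q (u + (M ∸ q)) (suc f)
    (trans (+-assoc u (M ∸ q) q) (trans (cong (u +_) (m∸n+n≡m q≤M)) (sym balanced)))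
... | no q≰M rewrite fall-vanishes M q (≰⇒> q≰M) | *-zeroʳ u =
  trans (fall-suc M q) (cong (_* (M ∸ q)) (fall-vanishes M q (≰⇒> q≰M)))

fall-balance-scaled : ∀ u M q f I → suc f + q ≡ u + M →
  u * (I * fall M q * f !) + M * (I * fall (pred M) q * f !) ≡ I * fall M q * suc f !
fall-balance-scaled u M q f I balanced = begin
    u * (I * fall M q * f !) + M * (I * fall (pred M) q * f !) ≡⟨ regroup u M (fall M q) (fall (pred M) q) (f !) I ⟩
    I * f ! * (u * fall M q + M * fall (pred M) q)             ≡⟨ cong (I * f ! *_) (fall-balance u M q f balanced) ⟩
    I * f ! * (fall M q * suc f)                               ≡⟨ regroup′ I (f !) (fall M q) (suc f) ⟩
    I * fall M q * suc f !                                     ∎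
  where
  open ≡-Reasoning
  regroup : ∀ u M a b F I → u * (I * a * F) + M * (I * b * F) ≡ I * F * (u * a + M * b)
  regroup = solve-∀
  regroup′ : ∀ I F a s → I * F * (a * s) ≡ I * a * (s * F)
  regroup′ = solve-∀

sumList-allVecs : ∀ r N (f : Vec (Fin N) (suc r) → ℕ) →
  sumList f (allVecs (suc r) N) ≡ sumFin (λ x → sumList (λ v → f (x ∷ v)) (allVecs r N))
sumList-allVecs r N f =
  trans (sumList-concatMap f (λ x → map (x ∷_) (allVecs r N)) (allFin N))
    (trans (sumList-cong (allFin N) (λ x → sumList-map f (x ∷_) (allVecs r N)))
      (sumList-allFin (λ x → sumList (λ v → f (x ∷ v)) (allVecs r N))))

sumFin-split : ∀ {n} (P Q : Fin n → Bool) x → (∀ y → y ≢ x → Q y ≡ P y) → Q x ≡ false →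
  sumFin (λ y → 𝟙 (P y)) ≡ 𝟙 (P x) + sumFin (λ y → 𝟙 (Q y))
sumFin-split P Q x Q≗P Qx = begin
    sumFin (λ y → 𝟙 (P y))                                      ≡⟨ sumFin-cong split ⟩
    sumFin (λ y → 𝟙 (y == x) * 𝟙 (P x) + 𝟙 (Q y))               ≡⟨ sumFin-+ (λ y → 𝟙 (y == x) * 𝟙 (P x)) (λ y → 𝟙 (Q y)) ⟩
    sumFin (λ y → 𝟙 (y == x) * 𝟙 (P x)) + sumFin (λ y → 𝟙 (Q y)) ≡⟨ cong (_+ _) (sumFin-point x (λ _ → 𝟙 (P x))) ⟩
    𝟙 (P x) + sumFin (λ y → 𝟙 (Q y))                            ∎
  where
  open ≡-Reasoning
  split : ∀ y → 𝟙 (P y) ≡ 𝟙 (y == x) * 𝟙 (P x) + 𝟙 (Q y)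
  split y with y ≟ x
  ... | yes refl rewrite Qx = sym (trans (+-identityʳ _) (+-identityʳ _))
  ... | no y≢x = cong 𝟙 (sym (Q≗P y y≢x))

-- Counting injective fillings of a vector under positional constraints.
module Completions (N : ℕ) (inS : Fin N → Bool) where
  open DistinctLists {N}

  data Constraint : Set where
    free outside : Constraint
    pinned : Fin N → Constraint

  allows : Constraint → Fin N → Bool
  allows free x = true
  allows outside x = not (inS x)
  allows (pinned v) x = x == v

  satisfies : ∀ {r} → Vec Constraint r → Vec (Fin N) r → Bool
  satisfies [] [] = true
  satisfies (t ∷ cs) (x ∷ v) = allows t x ∧ satisfies cs v

  hit : Constraint → Fin N → ℕ
  hit free x = 𝟙 (inS x)
  hit outside x = 0
  hit (pinned _) x = 0

  freeHits : ∀ {r} → Vec Constraint r → Vec (Fin N) r → ℕ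
  freeHits [] [] = 0
  freeHits (t ∷ cs) (x ∷ v) = hit t x + freeHits cs v

  pinnedValues : ∀ {r} → Vec Constraint r → List (Fin N)
  pinnedValues [] = []
  pinnedValues (free ∷ cs) = pinnedValues cs
  pinnedValues (outside ∷ cs) = pinnedValues cs
  pinnedValues (pinned v ∷ cs) = v ∷ pinnedValues cs

  #free #outside : ∀ {r} → Vec Constraint r → ℕ
  #free [] = 0
  #free (free ∷ cs) = suc (#free cs)
  #free (outside ∷ cs) = #free cs
  #free (pinned _ ∷ cs) = #free cs
  #outside [] = 0
  #outside (free ∷ cs) = #outside cs
  #outside (outside ∷ cs) = suc (#outside cs)
  #outside (pinned _ ∷ cs) = #outside cs

  allInS : List (Fin N) → Bool
  allInS [] = true
  allInS (x ∷ E) = inS x ∧ allInS E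

  count : ∀ r → List (Fin N) → Vec Constraint r → (ℕ → Bool) → ℕ
  count r L cs φ = sumList (λ v → 𝟙 (distinctFrom L (toList v) ∧ (satisfies cs v ∧ φ (freeHits cs v)))) (allVecs r N)

  spareIn : List (Fin N) → List (Fin N) → ℕ
  spareIn L E = sumFin (λ y → 𝟙 (inS y ∧ ((y ∉ᵇ L) ∧ (y ∉ᵇ E))))

  spareOut : List (Fin N) → ℕ
  spareOut L = sumFin (λ y → 𝟙 (not (inS y) ∧ (y ∉ᵇ L)))

  spareIn-∷ : ∀ x L E → spareIn L E ≡ 𝟙 (inS x ∧ ((x ∉ᵇ L) ∧ (x ∉ᵇ E))) + spareIn (x ∷ L) E
  spareIn-∷ x L E = sumFin-split _ _ x agree excluded
    where
    agree : ∀ y → y ≢ x → (inS y ∧ ((y ∉ᵇ x ∷ L) ∧ (y ∉ᵇ E))) ≡ (inS y ∧ ((y ∉ᵇ L) ∧ (y ∉ᵇ E)))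
    agree y y≢x rewrite ∉ᵇ-∷ L y≢x = refl
    excluded : (inS x ∧ ((x ∉ᵇ x ∷ L) ∧ (x ∉ᵇ E))) ≡ false
    excluded rewrite ∉ᵇ-self x L = ∧-zeroʳ (inS x)

  spareOut-∷ : ∀ x L → spareOut L ≡ 𝟙 (not (inS x) ∧ (x ∉ᵇ L)) + spareOut (x ∷ L)
  spareOut-∷ x L = sumFin-split _ _ x agree excluded
    where
    agree : ∀ y → y ≢ x → (not (inS y) ∧ (y ∉ᵇ x ∷ L)) ≡ (not (inS y) ∧ (y ∉ᵇ L))
    agree y y≢x rewrite ∉ᵇ-∷ L y≢x = refl
    excluded : (not (inS x) ∧ (x ∉ᵇ x ∷ L)) ≡ false
    excluded rewrite ∉ᵇ-self x L = ∧-zeroʳ (not (inS x))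

  spareIn-take : ∀ x L E → inS x ≡ true → (x ∉ᵇ L) ≡ true → (x ∉ᵇ E) ≡ true → spareIn L E ≡ suc (spareIn (x ∷ L) E)
  spareIn-take x L E x∈S x∉L x∉E = trans (spareIn-∷ x L E) (cong (λ b → 𝟙 b + spareIn (x ∷ L) E) taken)
    where
    taken : (inS x ∧ ((x ∉ᵇ L) ∧ (x ∉ᵇ E))) ≡ true
    taken rewrite x∈S | x∉L | x∉E = refl

  spareIn-outside : ∀ x L E → inS x ≡ false → spareIn (x ∷ L) E ≡ spareIn L E
  spareIn-outside x L E x∉S = sym (trans (spareIn-∷ x L E) (cong (λ b → 𝟙 (b ∧ ((x ∉ᵇ L) ∧ (x ∉ᵇ E))) + spareIn (x ∷ L) E) x∉S))

  spareIn-shift : ∀ v L E → spareIn (v ∷ L) E ≡ spareIn L (v ∷ E)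
  spareIn-shift v L E = sumFin-cong (λ y → cong (λ b → 𝟙 (inS y ∧ b)) (reorder (not (y == v)) (y ∉ᵇ L) (y ∉ᵇ E)))
    where
    reorder : ∀ a b c → ((a ∧ b) ∧ c) ≡ (b ∧ (a ∧ c))
    reorder true b c = refl
    reorder false b c = sym (∧-zeroʳ b)

  spareOut-take : ∀ x L → inS x ≡ false → (x ∉ᵇ L) ≡ true → spareOut L ≡ suc (spareOut (x ∷ L))
  spareOut-take x L x∉S x∉L = trans (spareOut-∷ x L) (cong (λ b → 𝟙 b + spareOut (x ∷ L)) taken)
    where
    taken : (not (inS x) ∧ (x ∉ᵇ L)) ≡ true
    taken rewrite x∉S | x∉L = refl

  spareOut-inside : ∀ x L → inS x ≡ true → spareOut (x ∷ L) ≡ spareOut L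
  spareOut-inside x L x∈S = sym (trans (spareOut-∷ x L) (cong (λ b → 𝟙 (not b ∧ (x ∉ᵇ L)) + spareOut (x ∷ L)) x∈S))

  outside-∉ : ∀ x E → allInS E ≡ true → inS x ≡ false → (x ∉ᵇ E) ≡ true
  outside-∉ x [] _ _ = refl
  outside-∉ x (y ∷ E) E⊆S x∉S with ∧-split {inS y} E⊆S
  ... | y∈S , E⊆S′ with x ≟ y
  ... | yes refl = ⊥-elim (false≢true (trans (sym x∉S) y∈S))
  ... | no _ = outside-∉ x E E⊆S′ x∉S

  count-step : ∀ r L t (cs : Vec Constraint r) φ →
    count (suc r) L (t ∷ cs) φ ≡ sumFin (λ x → 𝟙 ((x ∉ᵇ L) ∧ allows t x) * count r (x ∷ L) cs (λ s → φ (hit t x + s)))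
  count-step r L t cs φ = trans (sumList-allVecs r N _) (sumFin-cong first)
    where
    first : ∀ x → sumList (λ v → 𝟙 (distinctFrom L (x ∷ toList v) ∧ (satisfies (t ∷ cs) (x ∷ v) ∧ φ (freeHits (t ∷ cs) (x ∷ v))))) (allVecs r N)
                ≡ 𝟙 ((x ∉ᵇ L) ∧ allows t x) * count r (x ∷ L) cs (λ s → φ (hit t x + s))
    first x with x ∉ᵇ L | allows t x
    ... | false | _ = sumList-zero _ (allVecs r N) (λ _ → refl)
    ... | true | false = sumList-zero _ (allVecs r N) (λ v → cong 𝟙 (∧-zeroʳ (distinctFrom (x ∷ L) (toList v))))
    ... | true | true = sym (+-identityʳ _)

  count-clash : ∀ r (cs : Vec Constraint r) L φ → distinctFrom L (pinnedValues cs) ≡ false → count r L cs φ ≡ 0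
  count-clash (suc r) (free ∷ cs) L φ clash = trans (count-step r L free cs φ) (sumFin-zero _ at)
    where
    at : ∀ x → 𝟙 ((x ∉ᵇ L) ∧ true) * count r (x ∷ L) cs (λ s → φ (𝟙 (inS x) + s)) ≡ 0
    at x = trans (cong (𝟙 ((x ∉ᵇ L) ∧ true) *_) (count-clash r cs (x ∷ L) (λ s → φ (𝟙 (inS x) + s))
             (distinctFrom-drop x L (pinnedValues cs) clash))) (*-zeroʳ (𝟙 ((x ∉ᵇ L) ∧ true)))
  count-clash (suc r) (outside ∷ cs) L φ clash = trans (count-step r L outside cs φ) (sumFin-zero _ at)
    where
    at : ∀ x → 𝟙 ((x ∉ᵇ L) ∧ not (inS x)) * count r (x ∷ L) cs φ ≡ 0
    at x = trans (cong (𝟙 ((x ∉ᵇ L) ∧ not (inS x)) *_) (count-clash r cs (x ∷ L) φ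
             (distinctFrom-drop x L (pinnedValues cs) clash))) (*-zeroʳ (𝟙 ((x ∉ᵇ L) ∧ not (inS x))))
  count-clash (suc r) (pinned v ∷ cs) L φ clash = trans (count-step r L (pinned v) cs φ) (sumFin-zero _ at)
    where
    at : ∀ x → 𝟙 ((x ∉ᵇ L) ∧ (x == v)) * count r (x ∷ L) cs φ ≡ 0
    at x with x ≟ v
    ... | no _ rewrite ∧-zeroʳ (x ∉ᵇ L) = refl
    ... | yes refl with x ∉ᵇ L
    ...   | false = refl
    ...   | true = trans (+-identityʳ _) (count-clash r cs (x ∷ L) φ clash)

  record Admissible {r} (L : List (Fin N)) (cs : Vec Constraint r) : Set where
    field
      distinct : distinctFrom L (pinnedValues cs) ≡ true
      inside   : allInS (pinnedValues cs) ≡ true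
      balanced : #free cs + #outside cs ≡ spareIn L (pinnedValues cs) + spareOut L

  -- The free slots take exactly the spare values of S, hence freeHits is determined;
  -- the outside slots choose injectively among the spare outside values, and the free
  -- slots then take the remaining values in any order.
  Formula : ∀ {r} → List (Fin N) → Vec Constraint r → (ℕ → Bool) → ℕ
  Formula L cs φ = 𝟙 (φ (spareIn L (pinnedValues cs))) * fall (spareOut L) (#outside cs) * #free cs !

  CountFormula : ℕ → Set
  CountFormula r = ∀ (cs : Vec Constraint r) L (φ : ℕ → Bool) → Admissible L cs → count r L cs φ ≡ Formula L cs φ

  count-empty : CountFormula zero
  count-empty [] L φ adm = trans (+-identityʳ _) (sym (trans (*-identityʳ _) (trans (*-identityʳ _) (cong (λ u → 𝟙 (φ u)) no-spare))))
    where
    no-spare : spareIn L [] ≡ 0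
    no-spare = m+n≡0⇒m≡0 (spareIn L []) (sym (Admissible.balanced adm))

  FormulaAfter : ℕ → Constraint → Set
  FormulaAfter r t = ∀ (cs : Vec Constraint r) L (φ : ℕ → Bool) → Admissible L (t ∷ cs) → count (suc r) L (t ∷ cs) φ ≡ Formula L (t ∷ cs) φ

  count-pinned : ∀ {r} → CountFormula r → ∀ v → FormulaAfter r (pinned v)
  count-pinned {r} formula v cs L φ adm = begin
      count (suc r) L (pinned v ∷ cs) φ                              ≡⟨ count-step r L (pinned v) cs φ ⟩
      sumFin (λ x → 𝟙 ((x ∉ᵇ L) ∧ (x == v)) * count r (x ∷ L) cs φ) ≡⟨ sumFin-cong only-v ⟩
      sumFin (λ x → 𝟙 (x == v) * count r (x ∷ L) cs φ)              ≡⟨ sumFin-point v (λ x → count r (x ∷ L) cs φ) ⟩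
      count r (v ∷ L) cs φ                                            ≡⟨ formula cs (v ∷ L) φ adm′ ⟩
      Formula (v ∷ L) cs φ                                            ≡⟨ cong₂ (λ u m → 𝟙 (φ u) * fall m (#outside cs) * #free cs !)
                                                                           (spareIn-shift v L E) (spareOut-inside v L v∈S) ⟩
      Formula L (pinned v ∷ cs) φ                                     ∎
    where
    open ≡-Reasoning
    open Admissible adm
    E = pinnedValues cs
    v∉L = proj₁ (∧-split {v ∉ᵇ L} distinct)
    v∈S = proj₁ (∧-split {inS v} inside)
    only-v : ∀ x → 𝟙 ((x ∉ᵇ L) ∧ (x == v)) * count r (x ∷ L) cs φ ≡ 𝟙 (x == v) * count r (x ∷ L) cs φ
    only-v x with x ≟ v
    ... | yes refl rewrite v∉L = refl
    ... | no _ rewrite ∧-zeroʳ (x ∉ᵇ L) = refl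
    adm′ : Admissible (v ∷ L) cs
    adm′ = record
      { distinct = proj₂ (∧-split {v ∉ᵇ L} distinct)
      ; inside = proj₂ (∧-split {inS v} inside)
      ; balanced = trans balanced (cong₂ _+_ (sym (spareIn-shift v L E)) (sym (spareOut-inside v L v∈S)))
      }

  place-outside : ∀ {r} → CountFormula r → ∀ (cs : Vec Constraint r) L (φ : ℕ → Bool) x → inS x ≡ false → (x ∉ᵇ L) ≡ true →
    distinctFrom L (pinnedValues cs) ≡ true → allInS (pinnedValues cs) ≡ true →
    suc (#free cs + #outside cs) ≡ spareIn L (pinnedValues cs) + spareOut L →
    count r (x ∷ L) cs φ ≡ 𝟙 (φ (spareIn L (pinnedValues cs))) * fall (pred (spareOut L)) (#outside cs) * #free cs !
  place-outside formula cs L φ x x∉S x∉L distinct inside balanced =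
    trans (formula cs (x ∷ L) φ adm) (cong₂ (λ u m → 𝟙 (φ u) * fall m (#outside cs) * #free cs !) in-same out-less)
    where
    E = pinnedValues cs
    in-same : spareIn (x ∷ L) E ≡ spareIn L E
    in-same = spareIn-outside x L E x∉S
    out-less : spareOut (x ∷ L) ≡ pred (spareOut L)
    out-less = cong pred (sym (spareOut-take x L x∉S x∉L))
    adm : Admissible (x ∷ L) cs
    adm = record
      { distinct = distinctFrom-∷ x L E distinct (outside-∉ x E inside x∉S)
      ; inside = inside
      ; balanced = suc-injective (trans balanced (trans (cong₂ _+_ (sym in-same) (spareOut-take x L x∉S x∉L))
                     (+-suc (spareIn (x ∷ L) E) (spareOut (x ∷ L)))))
      }

  place-inside : ∀ {r} → CountFormula r → ∀ (cs : Vec Constraint r) L (φ : ℕ → Bool) x → inS x ≡ true → (x ∉ᵇ L) ≡ true →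
    (x ∉ᵇ pinnedValues cs) ≡ true → distinctFrom L (pinnedValues cs) ≡ true → allInS (pinnedValues cs) ≡ true →
    suc (#free cs + #outside cs) ≡ spareIn L (pinnedValues cs) + spareOut L →
    count r (x ∷ L) cs (λ s → φ (suc s)) ≡ 𝟙 (φ (spareIn L (pinnedValues cs))) * fall (spareOut L) (#outside cs) * #free cs !
  place-inside formula cs L φ x x∈S x∉L x∉E distinct inside balanced =
    trans (formula cs (x ∷ L) (λ s → φ (suc s)) adm)
      (cong₂ (λ u m → 𝟙 (φ u) * fall m (#outside cs) * #free cs !) (sym in-less) out-same)
    where
    E = pinnedValues cs
    in-less : spareIn L E ≡ suc (spareIn (x ∷ L) E)
    in-less = spareIn-take x L E x∈S x∉L x∉E
    out-same : spareOut (x ∷ L) ≡ spareOut L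
    out-same = spareOut-inside x L x∈S
    adm : Admissible (x ∷ L) cs
    adm = record
      { distinct = distinctFrom-∷ x L E distinct x∉E
      ; inside = inside
      ; balanced = suc-injective (trans balanced (cong₂ _+_ in-less (sym out-same)))
      }

  count-outside : ∀ {r} → CountFormula r → FormulaAfter r outside
  count-outside {r} formula cs L φ adm = begin
      count (suc r) L (outside ∷ cs) φ                                          ≡⟨ count-step r L outside cs φ ⟩
      sumFin (λ x → 𝟙 ((x ∉ᵇ L) ∧ not (inS x)) * count r (x ∷ L) cs φ)         ≡⟨ sumFin-cong each ⟩
      sumFin (λ x → 𝟙 (not (inS x) ∧ (x ∉ᵇ L)) * rest)                          ≡⟨ sumFin-*ʳ (λ x → 𝟙 (not (inS x) ∧ (x ∉ᵇ L))) rest ⟩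
      spareOut L * rest                                                         ≡⟨ regroup (spareOut L) (𝟙 (φ u)) (fall (pred (spareOut L)) q) (f !) ⟩
      Formula L (outside ∷ cs) φ                                                ∎
    where
    open ≡-Reasoning
    open Admissible adm
    u = spareIn L (pinnedValues cs)
    q = #outside cs
    f = #free cs
    rest = 𝟙 (φ u) * fall (pred (spareOut L)) q * f !
    regroup : ∀ M I a F → M * (I * a * F) ≡ I * (M * a) * F
    regroup = solve-∀
    each : ∀ x → 𝟙 ((x ∉ᵇ L) ∧ not (inS x)) * count r (x ∷ L) cs φ ≡ 𝟙 (not (inS x) ∧ (x ∉ᵇ L)) * rest
    each x with inS x in x∈S? | x ∉ᵇ L in x∉L?
    ... | true | true = refl
    ... | true | false = refl
    ... | false | false = refl
    ... | false | true = cong (_+ 0) (place-outside formula cs L φ x x∈S? x∉L? distinct inside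
                                        (trans (sym (+-suc f q)) balanced))

  -- Filling a free first slot with x: x is a spare value of S (one more hit), a spare value
  -- outside S, or a value of S pinned at a later slot (no filling at all).
  free-slot : ∀ {r} → CountFormula r → ∀ (cs : Vec Constraint r) L (φ : ℕ → Bool) → Admissible L (free ∷ cs) → ∀ x →
    𝟙 ((x ∉ᵇ L) ∧ true) * count r (x ∷ L) cs (λ s → φ (𝟙 (inS x) + s))
      ≡ 𝟙 (inS x ∧ ((x ∉ᵇ L) ∧ (x ∉ᵇ pinnedValues cs))) * Formula L cs φ
        + 𝟙 (not (inS x) ∧ (x ∉ᵇ L)) * (𝟙 (φ (spareIn L (pinnedValues cs))) * fall (pred (spareOut L)) (#outside cs) * #free cs !)
  free-slot {r} formula cs L φ adm x with inS x in x∈S? | x ∉ᵇ L in x∉L?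
  ... | true | false = refl
  ... | false | false = refl
  ... | false | true = cong (_+ 0) (place-outside formula cs L φ x x∈S? x∉L? distinct inside balanced)
    where open Admissible adm
  ... | true | true with x ∉ᵇ pinnedValues cs in x∉E?
  ...   | true = trans (cong (_+ 0) (place-inside formula cs L φ x x∈S? x∉L? x∉E? distinct inside balanced))
                       (sym (+-identityʳ _))
    where open Admissible adm
  ...   | false = trans (+-identityʳ _) (count-clash r cs (x ∷ L) (λ s → φ (suc s)) clash)
    where
    clash : distinctFrom (x ∷ L) (pinnedValues cs) ≡ false
    clash with distinctFrom (x ∷ L) (pinnedValues cs) in d
    ... | false = refl
    ... | true = trans (sym (distinctFrom-∉ x L (pinnedValues cs) d)) x∉E?

  count-free : ∀ {r} → CountFormula r → FormulaAfter r free
  count-free {r} formula cs L φ adm = begin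
      count (suc r) L (free ∷ cs) φ
        ≡⟨ count-step r L free cs φ ⟩
      sumFin (λ x → 𝟙 ((x ∉ᵇ L) ∧ true) * count r (x ∷ L) cs (λ s → φ (𝟙 (inS x) + s)))
        ≡⟨ sumFin-cong (free-slot formula cs L φ adm) ⟩
      sumFin (λ x → spareInAt x * inner + spareOutAt x * outer)
        ≡⟨ sumFin-+ (λ x → spareInAt x * inner) (λ x → spareOutAt x * outer) ⟩
      sumFin (λ x → spareInAt x * inner) + sumFin (λ x → spareOutAt x * outer)
        ≡⟨ cong₂ _+_ (sumFin-*ʳ spareInAt inner) (sumFin-*ʳ spareOutAt outer) ⟩
      u * inner + M * outer
        ≡⟨ fall-balance-scaled u M q f (𝟙 (φ u)) (Admissible.balanced adm) ⟩
      Formula L (free ∷ cs) φ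
        ∎
    where
    open ≡-Reasoning
    E = pinnedValues cs
    u = spareIn L E
    M = spareOut L
    q = #outside cs
    f = #free cs
    spareInAt spareOutAt : Fin N → ℕ
    spareInAt x = 𝟙 (inS x ∧ ((x ∉ᵇ L) ∧ (x ∉ᵇ E)))
    spareOutAt x = 𝟙 (not (inS x) ∧ (x ∉ᵇ L))
    inner = 𝟙 (φ u) * fall M q * f !
    outer = 𝟙 (φ u) * fall (pred M) q * f !

  count-formula : ∀ r → CountFormula r
  count-formula zero = count-empty
  count-formula (suc r) (free ∷ cs) = count-free (count-formula r) cs
  count-formula (suc r) (outside ∷ cs) = count-outside (count-formula r) cs
  count-formula (suc r) (pinned v ∷ cs) = count-pinned (count-formula r) v cs

  isFree isOutside : Constraint → Bool
  isFree free = true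
  isFree _ = false
  isOutside outside = true
  isOutside _ = false

  pinsTo : Constraint → Fin N → Bool
  pinsTo (pinned v) y = y == v
  pinsTo _ y = false

  satisfies-tabulate : ∀ {r} (t : Fin r → Constraint) v → satisfies (tabulate t) v ≡ allFinᵇ (λ p → allows (t p) (lookup v p))
  satisfies-tabulate t [] = refl
  satisfies-tabulate t (x ∷ v) = cong (allows (t zero) x ∧_) (satisfies-tabulate (λ p → t (suc p)) v)

  freeHits-tabulate : ∀ {r} (t : Fin r → Constraint) v → freeHits (tabulate t) v ≡ sumFin (λ p → hit (t p) (lookup v p))
  freeHits-tabulate t [] = refl
  freeHits-tabulate t (x ∷ v) = cong (hit (t zero) x +_) (freeHits-tabulate (λ p → t (suc p)) v)

  #free-tabulate : ∀ {r} (t : Fin r → Constraint) → #free (tabulate t) ≡ sumFin (λ p → 𝟙 (isFree (t p)))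
  #free-tabulate {zero} t = refl
  #free-tabulate {suc r} t with t zero
  ... | free = cong suc (#free-tabulate (λ p → t (suc p)))
  ... | outside = #free-tabulate (λ p → t (suc p))
  ... | pinned _ = #free-tabulate (λ p → t (suc p))

  #outside-tabulate : ∀ {r} (t : Fin r → Constraint) → #outside (tabulate t) ≡ sumFin (λ p → 𝟙 (isOutside (t p)))
  #outside-tabulate {zero} t = refl
  #outside-tabulate {suc r} t with t zero
  ... | free = #outside-tabulate (λ p → t (suc p))
  ... | outside = cong suc (#outside-tabulate (λ p → t (suc p)))
  ... | pinned _ = #outside-tabulate (λ p → t (suc p))

  ∉ᵇ-pinned-tabulate : ∀ {r} (t : Fin r → Constraint) y → (y ∉ᵇ pinnedValues (tabulate t)) ≡ allFinᵇ (λ p → not (pinsTo (t p) y))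
  ∉ᵇ-pinned-tabulate {zero} t y = refl
  ∉ᵇ-pinned-tabulate {suc r} t y with t zero
  ... | free = ∉ᵇ-pinned-tabulate (λ p → t (suc p)) y
  ... | outside = ∉ᵇ-pinned-tabulate (λ p → t (suc p)) y
  ... | pinned v = cong (not (y == v) ∧_) (∉ᵇ-pinned-tabulate (λ p → t (suc p)) y)

  allInS-tabulate : ∀ {r} (t : Fin r → Constraint) → (∀ p v → t p ≡ pinned v → inS v ≡ true) →
    allInS (pinnedValues (tabulate t)) ≡ true
  allInS-tabulate {zero} t _ = refl
  allInS-tabulate {suc r} t pinned∈S with t zero in t₀
  ... | free = allInS-tabulate (λ p → t (suc p)) (λ p → pinned∈S (suc p))
  ... | outside = allInS-tabulate (λ p → t (suc p)) (λ p → pinned∈S (suc p))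
  ... | pinned v rewrite pinned∈S zero v t₀ = allInS-tabulate (λ p → t (suc p)) (λ p → pinned∈S (suc p))

  distinct-tabulate : ∀ {r} (t : Fin r → Constraint) L → (∀ p v → t p ≡ pinned v → (v ∉ᵇ L) ≡ true) →
    (∀ p p′ v → t p ≡ pinned v → t p′ ≡ pinned v → p ≡ p′) → distinctFrom L (pinnedValues (tabulate t)) ≡ true
  distinct-tabulate {zero} t L _ _ = refl
  distinct-tabulate {suc r} t L avoid once with t zero in t₀
  ... | free = distinct-tabulate (λ p → t (suc p)) L (λ p → avoid (suc p)) (λ p p′ v tp tp′ → Fin.suc-injective (once (suc p) (suc p′) v tp tp′))
  ... | outside = distinct-tabulate (λ p → t (suc p)) L (λ p → avoid (suc p)) (λ p p′ v tp tp′ → Fin.suc-injective (once (suc p) (suc p′) v tp tp′))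
  ... | pinned w rewrite avoid zero w t₀ =
    distinct-tabulate (λ p → t (suc p)) (w ∷ L) avoid′ (λ p p′ v tp tp′ → Fin.suc-injective (once (suc p) (suc p′) v tp tp′))
    where
    avoid′ : ∀ p v → t (suc p) ≡ pinned v → (v ∉ᵇ w ∷ L) ≡ true
    avoid′ p v tp with v ≟ w
    ... | yes refl with once zero (suc p) v t₀ tp
    ...   | ()
    avoid′ p v tp | no _ = avoid (suc p) v tp

-- The points of the 4-cycle are indexed by Fin 4, and β moves i to next i.
-- A slot is where a permutation α sends a cycle point: just j for the cycle point j, or
-- nothing when it leaves the cycle.  A skeleton lists the slots of the four cycle points.
next : Fin 4 → Fin 4
next zero = suc zero
next (suc zero) = suc (suc zero)
next (suc (suc zero)) = suc (suc (suc zero))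
next (suc (suc (suc zero))) = zero

Slot : Set
Slot = Maybe (Fin 4)

Skeleton : Set
Skeleton = Vec Slot 4

_≟ₘ_ : (s t : Slot) → Dec (s ≡ t)
_≟ₘ_ = Maybe.≡-dec _≟_

_≟ₛ_ : ∀ {r} (σ τ : Vec Slot r) → Dec (σ ≡ τ)
_≟ₛ_ = Vec.≡-dec _≟ₘ_

slots : List Slot
slots = nothing ∷ map just (allFin 4)

slotVectors : ∀ r → List (Vec Slot r)
slotVectors zero = [] ∷ []
slotVectors (suc r) = concatMap (λ s → map (s ∷_) (slotVectors r)) slots

skeletons : List Skeleton
skeletons = slotVectors 4

slot-once : ∀ s → sumList (λ t → 𝟙 (does (s ≟ₘ t))) slots ≡ 1
slot-once nothing = refl
slot-once (just zero) = refl
slot-once (just (suc zero)) = refl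
slot-once (just (suc (suc zero))) = refl
slot-once (just (suc (suc (suc zero)))) = refl

slotVectors-once : ∀ r (σ : Vec Slot r) → sumList (λ τ → 𝟙 (does (σ ≟ₛ τ))) (slotVectors r) ≡ 1
slotVectors-once zero [] = refl
slotVectors-once (suc r) (s ∷ σ) = begin
    sumList (λ τ → 𝟙 (does ((s ∷ σ) ≟ₛ τ))) (concatMap (λ t → map (t ∷_) (slotVectors r)) slots)
      ≡⟨ sumList-concatMap _ (λ t → map (t ∷_) (slotVectors r)) slots ⟩
    sumList (λ t → sumList (λ τ → 𝟙 (does ((s ∷ σ) ≟ₛ τ))) (map (t ∷_) (slotVectors r))) slots
      ≡⟨ sumList-cong slots first ⟩
    sumList (λ t → 𝟙 (does (s ≟ₘ t))) slots
      ≡⟨ slot-once s ⟩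
    1 ∎
  where
  open ≡-Reasoning
  first : ∀ t → sumList (λ τ → 𝟙 (does ((s ∷ σ) ≟ₛ τ))) (map (t ∷_) (slotVectors r)) ≡ 𝟙 (does (s ≟ₘ t))
  first t = begin
      sumList (λ τ → 𝟙 (does ((s ∷ σ) ≟ₛ τ))) (map (t ∷_) (slotVectors r))
        ≡⟨ sumList-map _ (t ∷_) (slotVectors r) ⟩
      sumList (λ τ → 𝟙 (does (s ≟ₘ t) ∧ does (σ ≟ₛ τ))) (slotVectors r)
        ≡⟨ sumList-cong (slotVectors r) (λ τ → 𝟙-∧ (does (s ≟ₘ t)) (does (σ ≟ₛ τ))) ⟩
      sumList (λ τ → 𝟙 (does (s ≟ₘ t)) * 𝟙 (does (σ ≟ₛ τ))) (slotVectors r)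
        ≡⟨ sumList-*ˡ (𝟙 (does (s ≟ₘ t))) _ (slotVectors r) ⟩
      𝟙 (does (s ≟ₘ t)) * sumList (λ τ → 𝟙 (does (σ ≟ₛ τ))) (slotVectors r)
        ≡⟨ cong (𝟙 (does (s ≟ₘ t)) *_) (slotVectors-once r σ) ⟩
      𝟙 (does (s ≟ₘ t)) * 1
        ≡⟨ *-identityʳ _ ⟩
      𝟙 (does (s ≟ₘ t)) ∎

allᵇ : ∀ {A : Set} → (A → Bool) → List A → Bool
allᵇ p [] = true
allᵇ p (x ∷ xs) = p x ∧ allᵇ p xs

by-enumeration : ∀ (p : Skeleton → Bool) → allᵇ p skeletons ≡ true → ∀ σ → p σ ≡ true
by-enumeration p holds σ = listed skeletons holds (slotVectors-once 4 σ)
  where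
  listed : ∀ xs → allᵇ p xs ≡ true → sumList (λ τ → 𝟙 (does (σ ≟ₛ τ))) xs ≡ 1 → p σ ≡ true
  listed (τ ∷ xs) holds once with σ ≟ₛ τ
  ... | yes refl = proj₁ (∧-split {p σ} holds)
  ... | no _ = listed xs (proj₂ (∧-split {p τ} holds)) once

-- Statistics of a skeleton σ (for α with skeleton σ):
--   mismatches σ : cycle points x with α β x ≠ β α x.  If α sends e i off the cycle, β fixes
--                  α (e i) while α β (e i) = α (e (next i)) differs from it; if α (e i) = e j,
--                  then β α (e i) = e (next j) is compared with the slot of next i.
--   missed σ     : cycle points outside the image of the cycle under α;
--   escapes σ    : cycle points sent off the cycle.
mismatch : Slot → Slot → Bool
mismatch nothing t = true
mismatch (just j) t = not (does (t ≟ₘ just (next j)))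

mismatches : Skeleton → ℕ
mismatches σ = sumFin (λ i → 𝟙 (mismatch (lookup σ i) (lookup σ (next i))))

missedAt : Skeleton → Fin 4 → Bool
missedAt σ j = allFinᵇ (λ i → not (does (lookup σ i ≟ₘ just j)))

missed : Skeleton → ℕ
missed σ = sumFin (λ j → 𝟙 (missedAt σ j))

escapes : Skeleton → ℕ
escapes σ = sumFin (λ i → 𝟙 (is-nothing (lookup σ i)))

-- Skeletons of permutations never send two cycle points to the same cycle point.
collide : Slot → Slot → Bool
collide (just j) (just j′) = j == j′
collide _ _ = false

clashFree : Skeleton → Bool
clashFree σ = allFinᵇ (λ i → allFinᵇ (λ i′ → (i == i′) ∨ not (collide (lookup σ i) (lookup σ i′))))

clashFree-injective : ∀ σ → clashFree σ ≡ true → ∀ i i′ j → lookup σ i ≡ just j → lookup σ i′ ≡ just j → i ≡ i′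
clashFree-injective σ free i i′ j σi σi′
  with allFinᵇ-elim (λ i′ → (i == i′) ∨ not (collide (lookup σ i) (lookup σ i′)))
         (allFinᵇ-elim (λ i → allFinᵇ (λ i′ → (i == i′) ∨ not (collide (lookup σ i) (lookup σ i′)))) free i) i′
... | ok with i ≟ i′
... | yes i≡i′ = i≡i′
... | no _ = ⊥-elim (false≢true (trans (sym same) ok))
  where
  same : not (collide (lookup σ i) (lookup σ i′)) ≡ false
  same = trans (cong₂ (λ s t → not (collide s t)) σi σi′) (cong not (==-refl j))

escapes≡missed : ∀ σ → clashFree σ ≡ true → escapes σ ≡ missed σ
escapes≡missed σ free = ≡ᵇ⇒≡ (escapes σ) (missed σ) (≡true⇒T (trans (sym (cong (λ b → not b ∨ (escapes σ ≡ᵇ missed σ)) free)) (by-enumeration balanced refl σ)))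
  where
  balanced : Skeleton → Bool
  balanced σ = not (clashFree σ) ∨ (escapes σ ≡ᵇ missed σ)

contributes : ℕ → Skeleton → Bool
contributes k σ = clashFree σ ∧ (mismatches σ + missed σ ≡ᵇ k)

-- For n = 4 + m, each contributing skeleton is realised by fall m (escapes σ) · m! permutations.
total : ℕ → ℕ → ℕ
total k m = sumList (λ σ → 𝟙 (contributes k σ) * (fall m (escapes σ) * m !)) skeletons

-- mismatches and missed are each at most 4.
total-vanishes : ∀ k m → 9 ≤ k → total k m ≡ 0
total-vanishes k m 9≤k = sumList-zero _ skeletons none
  where
  none : ∀ σ → 𝟙 (contributes k σ) * (fall m (escapes σ) * m !) ≡ 0
  none σ with mismatches σ + missed σ ≡ᵇ k in eq
  ... | false rewrite ∧-zeroʳ (clashFree σ) = refl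
  ... | true = ⊥-elim (<⇒≱ (s≤s (+-mono-≤ (sumFin-𝟙≤ (λ i → mismatch (lookup σ i) (lookup σ (next i)))) (sumFin-𝟙≤ (missedAt σ))))
                       (subst (9 ≤_) (sym (≡ᵇ⇒≡ _ _ (≡true⇒T eq))) 9≤k))

tally : ℕ → ℕ → ℕ
tally k j = sumList (λ σ → 𝟙 (contributes k σ ∧ (escapes σ ≡ᵇ j))) skeletons

total-by-escapes : ∀ k m → total k m ≡ sumFin {5} (λ j → tally k (toℕ j) * (fall m (toℕ j) * m !))
total-by-escapes k m = begin
    total k m
      ≡⟨ sumList-cong skeletons split ⟩
    sumList (λ σ → sumFin {5} (λ j → 𝟙 (contributes k σ ∧ (escapes σ ≡ᵇ toℕ j)) * G (toℕ j))) skeletons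
      ≡⟨ sumList-sumFin (λ σ (j : Fin 5) → 𝟙 (contributes k σ ∧ (escapes σ ≡ᵇ toℕ j)) * G (toℕ j)) skeletons ⟩
    sumFin {5} (λ j → sumList (λ σ → 𝟙 (contributes k σ ∧ (escapes σ ≡ᵇ toℕ j)) * G (toℕ j)) skeletons)
      ≡⟨ sumFin-cong {5} (λ j → sumList-*ʳ (λ σ → 𝟙 (contributes k σ ∧ (escapes σ ≡ᵇ toℕ j))) (G (toℕ j)) skeletons) ⟩
    sumFin {5} (λ j → tally k (toℕ j) * G (toℕ j)) ∎
  where
  open ≡-Reasoning
  G : ℕ → ℕ
  G j = fall m j * m !
  at : ∀ q → q ≤ 4 → G q ≡ sumFin {5} (λ j → 𝟙 (q ≡ᵇ toℕ j) * G (toℕ j))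
  at 0 _ = sym (trans (+-identityʳ _) (+-identityʳ _))
  at 1 _ = sym (trans (+-identityʳ _) (+-identityʳ _))
  at 2 _ = sym (trans (+-identityʳ _) (+-identityʳ _))
  at 3 _ = sym (trans (+-identityʳ _) (+-identityʳ _))
  at 4 _ = sym (trans (+-identityʳ _) (+-identityʳ _))
  at (suc (suc (suc (suc (suc q))))) (s≤s (s≤s (s≤s (s≤s ()))))
  split : ∀ σ → 𝟙 (contributes k σ) * G (escapes σ)
              ≡ sumFin {5} (λ j → 𝟙 (contributes k σ ∧ (escapes σ ≡ᵇ toℕ j)) * G (toℕ j))
  split σ with contributes k σ
  ... | false = sym (sumFin-zero {5} _ (λ _ → refl))
  ... | true = trans (+-identityʳ _) (at (escapes σ) (sumFin-𝟙≤ (λ i → is-nothing (lookup σ i))))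

module FourCycle {n : ℕ} (β : Map n) (a b c′ d : Fin n)
  (a≢b : a ≢ b) (a≢c : a ≢ c′) (a≢d : a ≢ d) (b≢c : b ≢ c′) (b≢d : b ≢ d) (c≢d : c′ ≢ d)
  (βa : lookup β a ≡ b) (βb : lookup β b ≡ c′) (βc : lookup β c′ ≡ d) (βd : lookup β d ≡ a)
  (β-fixes : ∀ x → x ≢ a → x ≢ b → x ≢ c′ → x ≢ d → lookup β x ≡ x) where

  e : Fin 4 → Fin n
  e zero = a
  e (suc zero) = b
  e (suc (suc zero)) = c′
  e (suc (suc (suc zero))) = d

  e-injective : ∀ {i j} → e i ≡ e j → i ≡ j
  e-injective {zero} {zero} _ = refl
  e-injective {zero} {suc zero} eq = ⊥-elim (a≢b eq)
  e-injective {zero} {suc (suc zero)} eq = ⊥-elim (a≢c eq)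
  e-injective {zero} {suc (suc (suc zero))} eq = ⊥-elim (a≢d eq)
  e-injective {suc zero} {zero} eq = ⊥-elim (a≢b (sym eq))
  e-injective {suc zero} {suc zero} _ = refl
  e-injective {suc zero} {suc (suc zero)} eq = ⊥-elim (b≢c eq)
  e-injective {suc zero} {suc (suc (suc zero))} eq = ⊥-elim (b≢d eq)
  e-injective {suc (suc zero)} {zero} eq = ⊥-elim (a≢c (sym eq))
  e-injective {suc (suc zero)} {suc zero} eq = ⊥-elim (b≢c (sym eq))
  e-injective {suc (suc zero)} {suc (suc zero)} _ = refl
  e-injective {suc (suc zero)} {suc (suc (suc zero))} eq = ⊥-elim (c≢d eq)
  e-injective {suc (suc (suc zero))} {zero} eq = ⊥-elim (a≢d (sym eq))
  e-injective {suc (suc (suc zero))} {suc zero} eq = ⊥-elim (b≢d (sym eq))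
  e-injective {suc (suc (suc zero))} {suc (suc zero)} eq = ⊥-elim (c≢d (sym eq))
  e-injective {suc (suc (suc zero))} {suc (suc (suc zero))} _ = refl

  e-== : ∀ i j → (e i == e j) ≡ (i == j)
  e-== = ==-injective e e-injective

  β-e : ∀ i → lookup β (e i) ≡ e (next i)
  β-e zero = βa
  β-e (suc zero) = βb
  β-e (suc (suc zero)) = βc
  β-e (suc (suc (suc zero))) = βd

  next-moves : ∀ i → (i == next i) ≡ false
  next-moves zero = refl
  next-moves (suc zero) = refl
  next-moves (suc (suc zero)) = refl
  next-moves (suc (suc (suc zero))) = refl

  Off : Fin n → Set
  Off y = ∀ i → y ≢ e i

  β-off : ∀ y → Off y → lookup β y ≡ y
  β-off y y-off = β-fixes y (y-off zero) (y-off (suc zero)) (y-off (suc (suc zero))) (y-off (suc (suc (suc zero))))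

  data Located : Fin n → Set where
    at : ∀ i → Located (e i)
    off : ∀ {y} → Off y → Located y

  located : ∀ y → Located y
  located y with any? (λ i → y ≟ e i)
  ... | yes (i , refl) = at i
  ... | no ∄ = off (λ i y≡ei → ∄ (i , y≡ei))

  position : Fin n → Slot
  position y with any? (λ i → y ≟ e i)
  ... | yes (i , _) = just i
  ... | no _ = nothing

  onCycle : Fin n → Bool
  onCycle y = is-just (position y)

  position-e : ∀ i → position (e i) ≡ just i
  position-e i with any? (λ j → e i ≟ e j)
  ... | yes (j , ei≡ej) = cong just (e-injective (sym ei≡ej))
  ... | no ∄ = ⊥-elim (∄ (i , refl))

  position-off : ∀ {y} → Off y → position y ≡ nothing
  position-off {y} y-off with any? (λ i → y ≟ e i)
  ... | yes (i , y≡ei) = ⊥-elim (y-off i y≡ei)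
  ... | no _ = refl

  sumFin-cycle : (g : Fin n → ℕ) → (∀ y → Off y → g y ≡ 0) → sumFin g ≡ sumFin (λ i → g (e i))
  sumFin-cycle g vanish = begin
      sumFin g                                                ≡⟨ sumFin-cong spread ⟩
      sumFin (λ y → sumFin (λ i → 𝟙 (y == e i) * g (e i)))    ≡⟨ sumFin-swap (λ y i → 𝟙 (y == e i) * g (e i)) ⟩
      sumFin (λ i → sumFin (λ y → 𝟙 (y == e i) * g (e i)))    ≡⟨ sumFin-cong (λ i → sumFin-point (e i) (λ _ → g (e i))) ⟩
      sumFin (λ i → g (e i))                                  ∎
    where
    open ≡-Reasoning
    spread : ∀ y → g y ≡ sumFin (λ i → 𝟙 (y == e i) * g (e i))
    spread y with located y
    ... | at j = sym (trans (sumFin-cong (λ i → cong (λ b → 𝟙 b * g (e i)) (trans (e-== j i) (==-sym j i))))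
                            (sumFin-point j (λ i → g (e i))))
    ... | off y-off = trans (vanish y y-off) (sym (sumFin-zero _ (λ i → cong (λ b → 𝟙 b * g (e i)) (==-≢ (y-off i)))))

  allFinᵇ-cycle : (g : Fin n → Bool) → (∀ y → Off y → g y ≡ true) → allFinᵇ g ≡ allFinᵇ (λ i → g (e i))
  allFinᵇ-cycle g holds = Bool-ext
    (λ all → allFinᵇ-intro (λ i → g (e i)) (λ i → allFinᵇ-elim g all (e i)))
    (λ all → allFinᵇ-intro g (λ y → on y (located y) all))
    where
    on : ∀ y → Located y → allFinᵇ (λ i → g (e i)) ≡ true → g y ≡ true
    on _ (at i) all = allFinᵇ-elim (λ i → g (e i)) all i
    on y (off y-off) _ = holds y y-off

  onCycle-e : ∀ i → onCycle (e i) ≡ true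
  onCycle-e i rewrite position-e i = refl

  ==e-position : ∀ x j → (x == e j) ≡ does (position x ≟ₘ just j)
  ==e-position x j with located x
  ... | at i rewrite position-e i = e-== i j
  ... | off x-off rewrite position-off x-off = ==-≢ (x-off j)

  moved : ∀ x → not (x == lookup β x) ≡ onCycle x
  moved x with located x
  ... | at j rewrite β-e j | position-e j | e-== j (next j) | next-moves j = refl
  ... | off x-off rewrite β-off x x-off | ==-refl x | position-off x-off = refl

  -- The commutator test at a point x whose image under α is x′ ≠ z = α (β x), where z is
  -- compared with β x′: it only depends on the positions of x′ and z.
  mismatch-position : ∀ x z → x ≢ z → not (z == lookup β x) ≡ mismatch (position x) (position z)
  mismatch-position x z x≢z with located x
  ... | at j rewrite position-e j | β-e j = cong not (==e-position z (next j))
  ... | off x-off rewrite position-off x-off | β-off x x-off = cong not (==-≢ (λ z≡x → x≢z (sym z≡x)))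

  collide-position : ∀ x x′ → x ≢ x′ → collide (position x) (position x′) ≡ false
  collide-position x x′ x≢x′ with located x | located x′
  ... | at j | at j′ rewrite position-e j | position-e j′ = trans (sym (e-== j j′)) (==-≢ x≢x′)
  ... | at j | off x′-off rewrite position-e j | position-off x′-off = refl
  ... | off x-off | _ rewrite position-off x-off = refl

  open DistinctLists {n}
  open Completions n onCycle

  -- The skeleton of α and, conversely, the constraints describing the α with skeleton σ:
  -- off-cycle points are free, a cycle point sent off the cycle must go outside, and a
  -- cycle point sent to e j is pinned to e j.
  skeleton : Map n → Skeleton
  skeleton α = tabulate (λ i → position (lookup α (e i)))

  skeleton-at : ∀ α i → lookup (skeleton α) i ≡ position (lookup α (e i))
  skeleton-at α i = Vec.lookup∘tabulate (λ i → position (lookup α (e i))) i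

  slotConstraint : Slot → Constraint
  slotConstraint nothing = outside
  slotConstraint (just j) = pinned (e j)

  constraintAt : Skeleton → Slot → Constraint
  constraintAt σ nothing = free
  constraintAt σ (just i) = slotConstraint (lookup σ i)

  constraints : Skeleton → Vec Constraint n
  constraints σ = tabulate (λ y → constraintAt σ (position y))

  constraint-off : ∀ σ {y} → Off y → constraintAt σ (position y) ≡ free
  constraint-off σ y-off rewrite position-off y-off = refl

  constraint-e : ∀ σ i → constraintAt σ (position (e i)) ≡ slotConstraint (lookup σ i)
  constraint-e σ i rewrite position-e i = refl

  constraint-pinned : ∀ σ p v → constraintAt σ (position p) ≡ pinned v →
    Σ (Fin 4) λ i → Σ (Fin 4) λ j → p ≡ e i × lookup σ i ≡ just j × v ≡ e j
  constraint-pinned σ p v eq with located p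
  ... | off p-off rewrite position-off p-off = case eq
    where case : free ≡ pinned v → _
          case ()
  ... | at i rewrite position-e i with lookup σ i in σi
  ...   | nothing = case eq
    where case : outside ≡ pinned v → _
          case ()
  ...   | just j = i , j , refl , σi , pinned-injective eq
    where pinned-injective : pinned (e j) ≡ pinned v → v ≡ e j
          pinned-injective refl = refl

  allows-slot : ∀ s x → allows (slotConstraint s) x ≡ does (position x ≟ₘ s)
  allows-slot nothing x with position x
  ... | nothing = refl
  ... | just _ = refl
  allows-slot (just j) x = ==e-position x j

  satisfies-skeleton : ∀ σ α → satisfies (constraints σ) α ≡ does (skeleton α ≟ₛ σ)
  satisfies-skeleton σ@(_ ∷ _ ∷ _ ∷ _ ∷ []) α = begin
      satisfies (constraints σ) α
        ≡⟨ satisfies-tabulate (λ y → constraintAt σ (position y)) α ⟩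
      allFinᵇ (λ y → allows (constraintAt σ (position y)) (lookup α y))
        ≡⟨ allFinᵇ-cycle _ (λ y y-off → cong (λ t → allows t (lookup α y)) (constraint-off σ y-off)) ⟩
      allFinᵇ (λ i → allows (constraintAt σ (position (e i))) (lookup α (e i)))
        ≡⟨ allFinᵇ-cong (λ i → trans (cong (λ t → allows t (lookup α (e i))) (constraint-e σ i)) (allows-slot (lookup σ i) (lookup α (e i)))) ⟩
      allFinᵇ (λ i → does (position (lookup α (e i)) ≟ₘ lookup σ i))
        ∎
    where open ≡-Reasoning

  m : ℕ
  m = spareOut []

  size : 4 + m ≡ n
  size = begin
      4 + m                                                        ≡⟨ cong (_+ m) (sym on-cycle) ⟩
      sumFin (λ y → 𝟙 (onCycle y)) + m                             ≡⟨ sumFin-+ (λ y → 𝟙 (onCycle y)) (λ y → 𝟙 (not (onCycle y) ∧ true)) ⟨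
      sumFin (λ y → 𝟙 (onCycle y) + 𝟙 (not (onCycle y) ∧ true))    ≡⟨ sumFin-cong (λ y → either (onCycle y)) ⟩
      sumFin {n} (λ _ → 1)                                         ≡⟨ sumFin-const n ⟩
      n                                                            ∎
    where
    open ≡-Reasoning
    on-cycle : sumFin (λ y → 𝟙 (onCycle y)) ≡ 4
    on-cycle = trans (sumFin-cycle _ (λ y y-off → cong (λ s → 𝟙 (is-just s)) (position-off y-off)))
                     (sumFin-cong {4} {g = λ _ → 1} (λ i → cong 𝟙 (onCycle-e i)))
    either : ∀ b → 𝟙 b + 𝟙 (not b ∧ true) ≡ 1
    either true = refl
    either false = refl

  #free-constraints : ∀ σ → #free (constraints σ) ≡ m
  #free-constraints σ = trans (#free-tabulate (λ y → constraintAt σ (position y))) (sumFin-cong (λ y → cong 𝟙 (free-at (position y))))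
    where
    free-at : ∀ s → isFree (constraintAt σ s) ≡ (is-nothing s ∧ true)
    free-at nothing = refl
    free-at (just i) with lookup σ i
    ... | nothing = refl
    ... | just _ = refl

  #outside-constraints : ∀ σ → #outside (constraints σ) ≡ escapes σ
  #outside-constraints σ =
    trans (#outside-tabulate (λ y → constraintAt σ (position y)))
      (trans (sumFin-cycle _ (λ y y-off → cong (λ t → 𝟙 (isOutside t)) (constraint-off σ y-off)))
        (sumFin-cong (λ i → cong 𝟙 (trans (cong isOutside (constraint-e σ i)) (outside-slot (lookup σ i))))))
    where
    outside-slot : ∀ s → isOutside (slotConstraint s) ≡ is-nothing s
    outside-slot nothing = refl
    outside-slot (just _) = refl

  spareIn-constraints : ∀ σ → spareIn [] (pinnedValues (constraints σ)) ≡ missed σ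
  spareIn-constraints σ =
    trans (sumFin-cycle _ (λ y y-off → cong (λ s → 𝟙 (is-just s ∧ (true ∧ (y ∉ᵇ P)))) (position-off y-off)))
      (sumFin-cong (λ j → cong 𝟙 (trans (cong (_∧ (true ∧ (e j ∉ᵇ P))) (onCycle-e j)) (unpinned j))))
    where
    P = pinnedValues (constraints σ)
    pins-slot : ∀ s j → pinsTo (slotConstraint s) (e j) ≡ does (s ≟ₘ just j)
    pins-slot nothing j = refl
    pins-slot (just j′) j = trans (e-== j j′) (==-sym j j′)
    unpinned : ∀ j → (e j ∉ᵇ P) ≡ missedAt σ j
    unpinned j = begin
        e j ∉ᵇ P
          ≡⟨ ∉ᵇ-pinned-tabulate (λ y → constraintAt σ (position y)) (e j) ⟩
        allFinᵇ (λ y → not (pinsTo (constraintAt σ (position y)) (e j)))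
          ≡⟨ allFinᵇ-cycle _ (λ y y-off → cong (λ t → not (pinsTo t (e j))) (constraint-off σ y-off)) ⟩
        allFinᵇ (λ i → not (pinsTo (constraintAt σ (position (e i))) (e j)))
          ≡⟨ allFinᵇ-cong (λ i → cong not (trans (cong (λ t → pinsTo t (e j)) (constraint-e σ i)) (pins-slot (lookup σ i) j))) ⟩
        missedAt σ j
          ∎
      where open ≡-Reasoning

  admissible : ∀ σ → clashFree σ ≡ true → Admissible [] (constraints σ)
  admissible σ σ-free = record
    { distinct = distinct-tabulate (λ y → constraintAt σ (position y)) [] (λ _ _ _ → refl) pinned-once
    ; inside = allInS-tabulate (λ y → constraintAt σ (position y)) pinned-on-cycle
    ; balanced = begin
        #free (constraints σ) + #outside (constraints σ) ≡⟨ cong₂ _+_ (#free-constraints σ) (#outside-constraints σ) ⟩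
        m + escapes σ                                     ≡⟨ cong (m +_) (escapes≡missed σ σ-free) ⟩
        m + missed σ                                      ≡⟨ +-comm m (missed σ) ⟩
        missed σ + m                                      ≡⟨ cong (_+ m) (spareIn-constraints σ) ⟨
        spareIn [] (pinnedValues (constraints σ)) + m     ∎
    }
    where
    open ≡-Reasoning
    pinned-on-cycle : ∀ p v → constraintAt σ (position p) ≡ pinned v → onCycle v ≡ true
    pinned-on-cycle p v eq with constraint-pinned σ p v eq
    ... | _ , j , _ , _ , refl = onCycle-e j
    pinned-once : ∀ p p′ v → constraintAt σ (position p) ≡ pinned v → constraintAt σ (position p′) ≡ pinned v → p ≡ p′
    pinned-once p p′ v eq eq′ with constraint-pinned σ p v eq | constraint-pinned σ p′ v eq′
    ... | i , j , refl , σi , refl | i′ , j′ , refl , σi′ , ej≡ej′ with e-injective ej≡ej′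
    ...   | refl = cong e (clashFree-injective σ σ-free i i′ j σi σi′)

  distance : Map n → ℕ
  distance α = sumFin (λ y → 𝟙 (not (lookup α (lookup β y) == lookup β (lookup α y))))

  H≡distance : ∀ (α : Map n) → H (α ∘ₚ β) (β ∘ₚ α) ≡ distance α
  H≡distance α = trans (length≡sumList (filter differ? (allFin n)))
    (trans (sumList-filter differ? (λ _ → 1) (allFin n)) (trans (sumList-allFin (λ y → 𝟙 (does (differ? y)) * 1)) (sumFin-cong each)))
    where
    differ? : ∀ (y : Fin n) → Dec (¬ (lookup (α ∘ₚ β) y ≡ lookup (β ∘ₚ α) y))
    differ? y = ¬? (lookup (α ∘ₚ β) y ≟ lookup (β ∘ₚ α) y)
    each : ∀ y → 𝟙 (does (differ? y)) * 1 ≡ 𝟙 (not (lookup α (lookup β y) == lookup β (lookup α y)))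
    each y rewrite Vec.lookup∘tabulate (λ y → lookup α (lookup β y)) y | Vec.lookup∘tabulate (λ y → lookup β (lookup α y)) y =
      *-identityʳ _

  apart : ∀ (α : Map n) → AllPairs _≢_ (toList α) → ∀ {i j} → i ≢ j → lookup α (e i) ≢ lookup α (e j)
  apart α α-perm i≢j eq = i≢j (e-injective (lookup-injective α α-perm _ _ eq))

  next-≢ : ∀ i → i ≢ next i
  next-≢ i i≡next = false≢true (trans (sym (next-moves i)) (trans (cong (i ==_) (sym i≡next)) (==-refl i)))

  -- For a permutation α, d(α) splits into the mismatches of its skeleton at the cycle points
  -- and the off-cycle points y with α y on the cycle (there βαy ≠ αy = αβy).
  distance-split : ∀ (α : Map n) → AllPairs _≢_ (toList α) → distance α ≡ mismatches (skeleton α) + freeHits (constraints (skeleton α)) α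
  distance-split α α-perm = begin
      distance α
        ≡⟨ sumFin-cong (λ y → split (onCycle y) (differs y)) ⟩
      sumFin (λ y → 𝟙 (onCycle y ∧ differs y) + 𝟙 (not (onCycle y) ∧ differs y))
        ≡⟨ sumFin-+ (λ y → 𝟙 (onCycle y ∧ differs y)) (λ y → 𝟙 (not (onCycle y) ∧ differs y)) ⟩
      sumFin (λ y → 𝟙 (onCycle y ∧ differs y)) + sumFin (λ y → 𝟙 (not (onCycle y) ∧ differs y))
        ≡⟨ cong₂ _+_ on-cycle off-cycle ⟩
      mismatches (skeleton α) + freeHits (constraints (skeleton α)) α
        ∎
    where
    open ≡-Reasoning
    σ = skeleton α
    differs : Fin n → Bool
    differs y = not (lookup α (lookup β y) == lookup β (lookup α y))
    split : ∀ b c → 𝟙 c ≡ 𝟙 (b ∧ c) + 𝟙 (not b ∧ c)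
    split true c = sym (+-identityʳ _)
    split false c = refl
    on-cycle : sumFin (λ y → 𝟙 (onCycle y ∧ differs y)) ≡ mismatches σ
    on-cycle = trans (sumFin-cycle _ (λ y y-off → cong (λ s → 𝟙 (is-just s ∧ differs y)) (position-off y-off)))
                     (sumFin-cong at-point)
      where
      at-point : ∀ i → 𝟙 (onCycle (e i) ∧ differs (e i)) ≡ 𝟙 (mismatch (lookup σ i) (lookup σ (next i)))
      at-point i rewrite onCycle-e i | β-e i | skeleton-at α i | skeleton-at α (next i) =
        cong 𝟙 (mismatch-position (lookup α (e i)) (lookup α (e (next i))) (apart α α-perm (next-≢ i)))
    off-cycle : sumFin (λ y → 𝟙 (not (onCycle y) ∧ differs y)) ≡ freeHits (constraints σ) α
    off-cycle = trans (sumFin-cong at-point) (sym (freeHits-tabulate (λ y → constraintAt σ (position y)) α))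
      where
      no-hit : ∀ s x → hit (slotConstraint s) x ≡ 0
      no-hit nothing x = refl
      no-hit (just _) x = refl
      at-point : ∀ y → 𝟙 (not (onCycle y) ∧ differs y) ≡ hit (constraintAt σ (position y)) (lookup α y)
      at-point y with located y
      ... | at i rewrite position-e i = sym (no-hit (lookup σ i) (lookup α (e i)))
      ... | off y-off rewrite position-off y-off | β-off y y-off = cong 𝟙 (moved (lookup α y))

  clashFree-skeleton : ∀ (α : Map n) → AllPairs _≢_ (toList α) → clashFree (skeleton α) ≡ true
  clashFree-skeleton α α-perm = allFinᵇ-intro _ (λ i → allFinᵇ-intro _ (λ i′ → pair i i′))
    where
    pair : ∀ i i′ → ((i == i′) ∨ not (collide (lookup (skeleton α) i) (lookup (skeleton α) i′))) ≡ true
    pair i i′ with i ≟ i′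
    ... | yes _ = refl
    ... | no i≢i′ rewrite skeleton-at α i | skeleton-at α i′ | collide-position _ _ (apart α α-perm i≢i′) = refl

  isPerm≡distinct : ∀ (α : Map n) → does (isPerm? α) ≡ distinctFrom [] (toList α)
  isPerm≡distinct α with isPerm? α | distinctFrom [] (toList α) in d
  ... | yes α-perm | true = refl
  ... | yes α-perm | false = trans (sym (distinctFrom-[] (toList α) α-perm)) d
  ... | no ¬perm | true = ⊥-elim (¬perm (distinctFrom-sound [] (toList α) d))
  ... | no ¬perm | false = refl

  c-as-sum : ∀ k → c k β ≡ sumList (λ α → 𝟙 (distinctFrom [] (toList α) ∧ (distance α ≡ᵇ k))) (allVecs n n)
  c-as-sum k = begin
      c k β
        ≡⟨ length≡sumList (filter at-k? (Sym n)) ⟩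
      sumList (λ _ → 1) (filter at-k? (Sym n))
        ≡⟨ sumList-filter at-k? (λ _ → 1) (Sym n) ⟩
      sumList (λ α → 𝟙 (does (at-k? α)) * 1) (filter isPerm? (allVecs n n))
        ≡⟨ sumList-filter isPerm? (λ α → 𝟙 (does (at-k? α)) * 1) (allVecs n n) ⟩
      sumList (λ α → 𝟙 (does (isPerm? α)) * (𝟙 (does (at-k? α)) * 1)) (allVecs n n)
        ≡⟨ sumList-cong (allVecs n n) each ⟩
      sumList (λ α → 𝟙 (distinctFrom [] (toList α) ∧ (distance α ≡ᵇ k))) (allVecs n n)
        ∎
    where
    open ≡-Reasoning
    at-k? : ∀ (α : Map n) → Dec (H (α ∘ₚ β) (β ∘ₚ α) ≡ k)
    at-k? α = H (α ∘ₚ β) (β ∘ₚ α) Data.Nat.≟ k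
      where import Data.Nat
    each : ∀ α → 𝟙 (does (isPerm? α)) * (𝟙 (does (at-k? α)) * 1) ≡ 𝟙 (distinctFrom [] (toList α) ∧ (distance α ≡ᵇ k))
    each α rewrite isPerm≡distinct α | H≡distance α | *-identityʳ (𝟙 (distance α ≡ᵇ k)) =
      sym (𝟙-∧ (distinctFrom [] (toList α)) (distance α ≡ᵇ k))

  withSkeleton : Skeleton → ℕ → ℕ
  withSkeleton σ k =
    sumList (λ α → 𝟙 (does (skeleton α ≟ₛ σ)) * 𝟙 (distinctFrom [] (toList α) ∧ (distance α ≡ᵇ k))) (allVecs n n)

  withSkeleton-count : ∀ σ k → withSkeleton σ k ≡ count n [] (constraints σ) (λ s → mismatches σ + s ≡ᵇ k)
  withSkeleton-count σ k = sumList-cong (allVecs n n) each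
    where
    each : ∀ α → 𝟙 (does (skeleton α ≟ₛ σ)) * 𝟙 (distinctFrom [] (toList α) ∧ (distance α ≡ᵇ k))
                 ≡ 𝟙 (distinctFrom [] (toList α) ∧ (satisfies (constraints σ) α ∧ (mismatches σ + freeHits (constraints σ) α ≡ᵇ k)))
    each α with distinctFrom [] (toList α) in α-distinct
    ... | false = *-zeroʳ (𝟙 (does (skeleton α ≟ₛ σ)))
    ... | true rewrite satisfies-skeleton σ α with skeleton α ≟ₛ σ
    ...   | no _ = refl
    ...   | yes refl rewrite distance-split α (distinctFrom-sound [] (toList α) α-distinct) = +-identityʳ _

  withSkeleton-clash : ∀ σ k → clashFree σ ≡ false → withSkeleton σ k ≡ 0
  withSkeleton-clash σ k clash = sumList-zero _ (allVecs n n) each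
    where
    each : ∀ α → 𝟙 (does (skeleton α ≟ₛ σ)) * 𝟙 (distinctFrom [] (toList α) ∧ (distance α ≡ᵇ k)) ≡ 0
    each α with distinctFrom [] (toList α) in α-distinct
    ... | false = *-zeroʳ (𝟙 (does (skeleton α ≟ₛ σ)))
    ... | true with skeleton α ≟ₛ σ
    ...   | no _ = refl
    ...   | yes refl = ⊥-elim (false≢true (trans (sym clash) (clashFree-skeleton α (distinctFrom-sound [] (toList α) α-distinct))))

  withSkeleton-total : ∀ σ k → withSkeleton σ k ≡ 𝟙 (contributes k σ) * (fall m (escapes σ) * m !)
  withSkeleton-total σ k with clashFree σ in σ-free
  ... | false = withSkeleton-clash σ k σ-free
  ... | true = begin
      withSkeleton σ k
        ≡⟨ withSkeleton-count σ k ⟩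
      count n [] (constraints σ) φ
        ≡⟨ count-formula n (constraints σ) [] φ (admissible σ σ-free) ⟩
      𝟙 (φ (spareIn [] (pinnedValues (constraints σ)))) * fall m (#outside (constraints σ)) * #free (constraints σ) !
        ≡⟨ cong₃ (spareIn-constraints σ) (#outside-constraints σ) (#free-constraints σ) ⟩
      𝟙 (φ (missed σ)) * fall m (escapes σ) * m !
        ≡⟨ *-assoc (𝟙 (φ (missed σ))) (fall m (escapes σ)) (m !) ⟩
      𝟙 (φ (missed σ)) * (fall m (escapes σ) * m !)
        ∎
    where
    open ≡-Reasoning
    φ : ℕ → Bool
    φ s = mismatches σ + s ≡ᵇ k
    cong₃ : ∀ {u u′ q q′ f f′} → u ≡ u′ → q ≡ q′ → f ≡ f′ → 𝟙 (φ u) * fall m q * f ! ≡ 𝟙 (φ u′) * fall m q′ * f′ !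
    cong₃ refl refl refl = refl

  c≡total : ∀ k → c k β ≡ total k m
  c≡total k = begin
      c k β
        ≡⟨ c-as-sum k ⟩
      sumList (λ α → X α) (allVecs n n)
        ≡⟨ sumList-cong (allVecs n n) by-skeleton ⟩
      sumList (λ α → sumList (λ σ → 𝟙 (does (skeleton α ≟ₛ σ)) * X α) skeletons) (allVecs n n)
        ≡⟨ sumList-swap (λ α σ → 𝟙 (does (skeleton α ≟ₛ σ)) * X α) (allVecs n n) skeletons ⟩
      sumList (λ σ → withSkeleton σ k) skeletons
        ≡⟨ sumList-cong skeletons (λ σ → withSkeleton-total σ k) ⟩
      total k m
        ∎
    where
    open ≡-Reasoning
    X : Map n → ℕ
    X α = 𝟙 (distinctFrom [] (toList α) ∧ (distance α ≡ᵇ k))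
    by-skeleton : ∀ α → X α ≡ sumList (λ σ → 𝟙 (does (skeleton α ≟ₛ σ)) * X α) skeletons
    by-skeleton α = sym (trans (sumList-*ʳ (λ σ → 𝟙 (does (skeleton α ≟ₛ σ))) (X α) skeletons)
                               (trans (cong (_* X α) (slotVectors-once 4 (skeleton α))) (*-identityˡ (X α))))

profile : (c₀ c₁ c₂ c₃ c₄ m : ℕ) → ℕ
profile c₀ c₁ c₂ c₃ c₄ m =
  c₀ * (fall m 0 * m !) + (c₁ * (fall m 1 * m !) + (c₂ * (fall m 2 * m !) + (c₃ * (fall m 3 * m !) + (c₄ * (fall m 4 * m !) + 0))))

-- The tally of contributing skeletons by k and number of escapes, computed by evaluation.
total-0 : ∀ m → total 0 m ≡ profile 4 0 0 0 0 m
total-0 m = total-by-escapes 0 m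

total-3 : ∀ m → total 3 m ≡ profile 16 16 0 0 0 m
total-3 m = total-by-escapes 3 m

total-4 : ∀ m → total 4 m ≡ profile 4 32 0 0 0 m
total-4 m = total-by-escapes 4 m

total-5 : ∀ m → total 5 m ≡ profile 0 48 16 0 0 m
total-5 m = total-by-escapes 5 m

total-6 : ∀ m → total 6 m ≡ profile 0 0 56 0 0 m
total-6 m = total-by-escapes 6 m

total-7 : ∀ m → total 7 m ≡ profile 0 0 0 16 0 m
total-7 m = total-by-escapes 7 m

total-8 : ∀ m → total 8 m ≡ profile 0 0 0 0 1 m
total-8 m = total-by-escapes 8 m

CountFormulas : ℕ → (ℕ → ℕ) → Set
CountFormulas n c =
      (4 ≤ n → c 0 ≡ 4 * (n ∸ 4) !)
    × (4 ≤ n → c 3 ≡ (4 * n ∸ 12) * (4 * (n ∸ 4) !))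
    × (4 ≤ n → c 4 ≡ (1 + 8 * (n ∸ 4)) * (4 * (n ∸ 4) !))
    × (5 ≤ n → c 5 ≡ (12 * (n ∸ 4) + 8 * ((n ∸ 4) C 2)) * (4 * (n ∸ 4) !))
    × (6 ≤ n → c 6 + (126 * n) * (4 * (n ∸ 4) !) ≡ (14 * n ^ 2 + 280) * (4 * (n ∸ 4) !))
    × (7 ≤ n → c 7 ≡ (24 * ((n ∸ 4) C 3)) * (4 * (n ∸ 4) !))
    × (8 ≤ n → c 8 ≡ (6 * ((n ∸ 4) C 4)) * (4 * (n ∸ 4) !))
    × ((k : ℕ) → 9 ≤ k → k ≤ n → c k ≡ 0)

-- Closed forms of the profiles; fall m j · m! is rewritten through j! · C(m, j).
profile-0 : ∀ m → profile 4 0 0 0 0 m ≡ 4 * m !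
profile-0 m = arith (m !)
  where
  arith : ∀ X → 4 * (1 * X) + 0 ≡ 4 * X
  arith = solve-∀

profile-3 : ∀ m → profile 16 16 0 0 0 m ≡ (4 * (4 + m) ∸ 12) * (4 * m !)
profile-3 m = trans (cong (λ f → 16 * (1 * m !) + (16 * (f * m !) + 0)) (*-identityʳ m))
                (trans (arith m (m !)) (cong (λ x → (x ∸ 12) * (4 * m !)) (sym (expand m))))
  where
  arith : ∀ m X → 16 * (1 * X) + (16 * (m * X) + 0) ≡ (4 + 4 * m) * (4 * X)
  arith = solve-∀
  expand : ∀ m → 4 * (4 + m) ≡ 12 + (4 + 4 * m)
  expand = solve-∀

profile-4 : ∀ m → profile 4 32 0 0 0 m ≡ (1 + 8 * m) * (4 * m !)
profile-4 m = trans (cong (λ f → 4 * (1 * m !) + (32 * (f * m !) + 0)) (*-identityʳ m)) (arith m (m !))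
  where
  arith : ∀ m X → 4 * (1 * X) + (32 * (m * X) + 0) ≡ (1 + 8 * m) * (4 * X)
  arith = solve-∀

profile-5 : ∀ m → profile 0 48 16 0 0 m ≡ (12 * m + 8 * (m C 2)) * (4 * m !)
profile-5 m = trans (cong₂ (λ f g → 48 * (f * m !) + (16 * (g * m !) + 0)) (*-identityʳ m) (fall≡!*C m 2)) (arith m (m C 2) (m !))
  where
  arith : ∀ m C X → 48 * (m * X) + (16 * (2 * C * X) + 0) ≡ (12 * m + 8 * C) * (4 * X)
  arith = solve-∀

profile-6 : ∀ m → profile 0 0 56 0 0 (2 + m) + (126 * (6 + m)) * (4 * (2 + m) !) ≡ (14 * (6 + m) ^ 2 + 280) * (4 * (2 + m) !)
profile-6 m = arith m ((2 + m) !)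
  where
  arith : ∀ m X → 56 * ((2 + m) * ((1 + m) * 1) * X) + 0 + (126 * (6 + m)) * (4 * X) ≡ (14 * ((6 + m) * ((6 + m) * 1)) + 280) * (4 * X)
  arith = solve-∀

profile-7 : ∀ m → profile 0 0 0 16 0 m ≡ (24 * (m C 3)) * (4 * m !)
profile-7 m = trans (cong (λ g → 16 * (g * m !) + 0) (fall≡!*C m 3)) (arith (m C 3) (m !))
  where
  arith : ∀ C X → 16 * (6 * C * X) + 0 ≡ (24 * C) * (4 * X)
  arith = solve-∀

profile-8 : ∀ m → profile 0 0 0 0 1 m ≡ (6 * (m C 4)) * (4 * m !)
profile-8 m = trans (cong (λ g → 1 * (g * m !) + 0) (fall≡!*C m 4)) (arith (m C 4) (m !))
  where
  arith : ∀ C X → 1 * (24 * C * X) + 0 ≡ (6 * C) * (4 * X)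
  arith = solve-∀

formula-6 : ∀ m c → c ≡ total 6 m → 6 ≤ 4 + m → c + (126 * (4 + m)) * (4 * m !) ≡ (14 * (4 + m) ^ 2 + 280) * (4 * m !)
formula-6 (suc (suc m)) c c≡total _ = trans (cong (_+ _) (trans c≡total (total-6 (2 + m)))) (profile-6 m)
formula-6 0 c _ (s≤s (s≤s (s≤s (s≤s ()))))
formula-6 1 c _ (s≤s (s≤s (s≤s (s≤s (s≤s ())))))

formulas : ∀ n m (c : ℕ → ℕ) → 4 + m ≡ n → (∀ k → c k ≡ total k m) → CountFormulas n c
formulas .(4 + m) m c refl c≡total =
    (λ _ → via 0 (trans (total-0 m) (profile-0 m)))
  , (λ _ → via 3 (trans (total-3 m) (profile-3 m)))
  , (λ _ → via 4 (trans (total-4 m) (profile-4 m)))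
  , (λ _ → via 5 (trans (total-5 m) (profile-5 m)))
  , (λ 6≤n → formula-6 m (c 6) (c≡total 6) 6≤n)
  , (λ _ → via 7 (trans (total-7 m) (profile-7 m)))
  , (λ _ → via 8 (trans (total-8 m) (profile-8 m)))
  , (λ k 9≤k _ → via k (total-vanishes k m 9≤k))
  where
  via : ∀ k {x} → total k m ≡ x → c k ≡ x
  via k = trans (c≡total k)

theorem3p4 : (n : ℕ) (β : Map n) → IsPerm β → IsFourCycle β →
      (4 ≤ n → c 0 β ≡ 4 * (n ∸ 4) !)
    × (4 ≤ n → c 3 β ≡ (4 * n ∸ 12) * (4 * (n ∸ 4) !))
    × (4 ≤ n → c 4 β ≡ (1 + 8 * (n ∸ 4)) * (4 * (n ∸ 4) !))
    × (5 ≤ n → c 5 β ≡ (12 * (n ∸ 4) + 8 * ((n ∸ 4) C 2)) * (4 * (n ∸ 4) !))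
    × (6 ≤ n → c 6 β + (126 * n) * (4 * (n ∸ 4) !) ≡ (14 * n ^ 2 + 280) * (4 * (n ∸ 4) !))
    × (7 ≤ n → c 7 β ≡ (24 * ((n ∸ 4) C 3)) * (4 * (n ∸ 4) !))
    × (8 ≤ n → c 8 β ≡ (6 * ((n ∸ 4) C 4)) * (4 * (n ∸ 4) !))
    × ((k : ℕ) → 9 ≤ k → k ≤ n → c k β ≡ 0)
theorem3p4 n β _ (a , b , c′ , d , (a≢b , a≢c , a≢d , b≢c , b≢d , c≢d) , (βa , βb , βc , βd) , β-fixes) =
  formulas n m (λ k → c k β) size c≡total
  where open FourCycle β a b c′ d a≢b a≢c a≢d b≢c b≢d c≢d βa βb βc βd β-fixes
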